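{- We have $$\begin{aligned} \langle z^n\rangle& \frac {\alpha\left(zM(z)\right)^{t-f+2}-\alpha^{f+1}\left(zM(z)\right)^{f+t+2}} {(1+xzM(z))(1-\alpha z^2M^2(z))}\\ &=\sum_{\substack{c,d,e\ge0\\ c+d+2e-f+t=n}} x^cy^d\alpha^{e} \left(\frac {(n-1)!} {(n-d-e)\,c!\,d!\,(e-1)!\,(e-f+t-1)!} -\frac {(n-1)!} {(n-d-e+f)\,c!\,d!\,(e-f-1)!\,(e+t-1)!}\right). \end{aligned}$$
   Context: $M(z)$ is the formal power series in $z$ (with coefficients polynomials in $x,y,\alpha$) satisfying $M(z)=1+(x+y)zM(z)+\alpha z^2M^2(z)$ (generating function of two-coloured Motzkin paths from $(0,0)$ ending on the $x$-axis). $\langle z^n\rangle$ denotes coefficient extraction; $n,f$ are positive integers and $t$ a non-negative integer (the lemma is applied with $t\ge f$). Any expression containing $m!$ with $m<0$ in the denominator is interpreted as $0$. -}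

module Defs where

open import Data.Nat as ℕ using (ℕ; zero; suc; _∸_; _!)
open import Data.Nat.Properties using (_!≢0)
open import Data.Integer as ℤ using (ℤ; +_; -[1+_])
open import Data.Rational using (ℚ; 0ℚ; 1ℚ; _+_; _-_; _*_; _/_; -_)
open import Relation.Binary.PropositionalEquality using (_≡_)
open import Data.Bool using (if_then_else_; _∧_)
open import Relation.Nullary.Decidable using (⌊_⌋)

-- Formal power series in z whose coefficients are polynomials in
-- x, y, α (with rational coefficients), represented by their
-- coefficient array:  S n c d e  =  coefficient of  z^n x^c y^d α^e.

Series : Set
Series = ℕ → ℕ → ℕ → ℕ → ℚ

Σ≤ : ℕ → (ℕ → ℚ) → ℚ
Σ≤ zero    g = g 0
Σ≤ (suc n) g = Σ≤ n g + g (suc n)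

infixl 6 _⊕_ _⊖_
infixl 7 _⊛_

_⊕_ : Series → Series → Series
(A ⊕ B) n c d e = A n c d e + B n c d e

_⊖_ : Series → Series → Series
(A ⊖ B) n c d e = A n c d e - B n c d e

_⊛_ : Series → Series → Series
(A ⊛ B) n c d e =
  Σ≤ n λ i → Σ≤ c λ j → Σ≤ d λ k → Σ≤ e λ l →
    A i j k l * B (n ∸ i) (c ∸ j) (d ∸ k) (e ∸ l)

mono : ℕ → ℕ → ℕ → ℕ → Series
mono n c d e n′ c′ d′ e′ =
  if ⌊ n ℕ.≟ n′ ⌋ ∧ ⌊ c ℕ.≟ c′ ⌋ ∧ ⌊ d ℕ.≟ d′ ⌋ ∧ ⌊ e ℕ.≟ e′ ⌋
  then 1ℚ else 0ℚ

𝟙 z x y α : Series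
𝟙 = mono 0 0 0 0
z = mono 1 0 0 0
x = mono 0 1 0 0
y = mono 0 0 1 0
α = mono 0 0 0 1

infixr 8 _^_
_^_ : Series → ℕ → Series
A ^ zero  = 𝟙
A ^ suc k = A ⊛ (A ^ k)

infix 4 _≋_
_≋_ : Series → Series → Set
A ≋ B = ∀ n c d e → A n c d e ≡ B n c d e

-- Coefficients on the right-hand side.
-- Convention of the paper: a term containing m! with m < 0 in the
-- denominator is 0.  invFact m = 1/m! for m ≥ 0 and 0 for m < 0.

invFact : ℤ → ℚ
invFact (+ m)    = _/_ (+ 1) (m !) {{m !≢0}}
invFact -[1+ m ] = 0ℚ

-- 1/k for an integer k ≠ 0.  (The value 0 at k = 0 is never used in a
-- nonzero term: whenever a linear denominator below vanishes, one of the
-- factorials in the same term has a negative argument.)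
recip : ℤ → ℚ
recip (+ zero)    = 0ℚ
recip (+ suc k)   = + 1 / suc k
recip -[1+ k ]    = - (+ 1 / suc k)

rhsCoeff : (f t n c d e : ℕ) → ℚ
rhsCoeff f t n c d e =
  (+ ((n ∸ 1) !) / 1) *
    ( recip (+ n ℤ.- + d ℤ.- + e) * invFact (+ c) * invFact (+ d)
        * invFact (+ e ℤ.- + 1) * invFact (+ e ℤ.- + f ℤ.+ + t ℤ.- + 1)
    - recip (+ n ℤ.- + d ℤ.- + e ℤ.+ + f) * invFact (+ c) * invFact (+ d)
        * invFact (+ e ℤ.- + f ℤ.- + 1) * invFact (+ e ℤ.+ + t ℤ.- + 1) )

module Submission where

-- Write w = z M, so that w = z (1 + (x + y) w + α w²). Multiplying this by w^j gives a recurrence,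
-- in the degree in z, for the coefficients of the powers of w; the Lagrange-inversion formula
-- [z^n x^c y^d α^e] w^j = j (n-1)! / (c! d! e! (e+j)!) for n = c+d+2e+j satisfies it, so it is correct.
-- Multiplication by (1 + x w)(1 - α w²) acts on sequences (V w^j)_j as an operator Φ, which is
-- injective by induction on the degrees in x and α. The hypothesis on L says that Φ maps (L w^j)_j
-- to ((α w^(t-f+2) - α^(f+1) w^(f+t+2)) w^j)_j. The explicit series P_k with coefficients
-- (n-1)! / ((c+e+k+1) c! d! e! (e+k)!) for n = c+d+2e+k+2 satisfy Φ P k = w^(k+2), checked directly
-- against the formula for w^(k+2). Hence L = α P_(t-f) - α^(f+1) P_(f+t), whose coefficients are
-- the ones claimed.

module FormalPowerSeries where

  open import Algebra.Bundles using (CommutativeRing)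
  open import Algebra.Structures using (IsCommutativeRing)
  open import Data.Nat using (ℕ; zero; suc; _∸_; _≤_; z≤n)
  import Data.Nat.Properties as ℕ
  open import Data.Product using (_,_)
  open import Function.Base using (_⟨_⟩_)

  sum≤ : ∀ {a} {A : Set a} → (A → A → A) → ℕ → (ℕ → A) → A
  sum≤ _+_ zero    g = g 0
  sum≤ _+_ (suc n) g = sum≤ _+_ n g + g (suc n)

  module PowerSeries {c ℓ} (R : CommutativeRing c ℓ) where
    open CommutativeRing R
    open import Relation.Binary.Reasoning.Setoid setoid

    ∑≤ : ℕ → (ℕ → Carrier) → Carrier
    ∑≤ = sum≤ _+_

    ∑≤-cong-≤ : ∀ n {f g} → (∀ {i} → i ≤ n → f i ≈ g i) → ∑≤ n f ≈ ∑≤ n g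
    ∑≤-cong-≤ zero    f≈g = f≈g z≤n
    ∑≤-cong-≤ (suc n) f≈g = +-cong (∑≤-cong-≤ n (λ i≤n → f≈g (ℕ.m≤n⇒m≤1+n i≤n))) (f≈g ℕ.≤-refl)

    ∑≤-cong : ∀ n {f g} → (∀ i → f i ≈ g i) → ∑≤ n f ≈ ∑≤ n g
    ∑≤-cong n f≈g = ∑≤-cong-≤ n (λ {i} _ → f≈g i)

    ∑≤-distrib-+ : ∀ n (f g : ℕ → Carrier) → ∑≤ n (λ i → f i + g i) ≈ ∑≤ n f + ∑≤ n g
    ∑≤-distrib-+ zero    f g = refl
    ∑≤-distrib-+ (suc n) f g = begin
      ∑≤ n (λ i → f i + g i) + (f (suc n) + g (suc n)) ≈⟨ +-congʳ (∑≤-distrib-+ n f g) ⟩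
      (∑≤ n f + ∑≤ n g) + (f (suc n) + g (suc n))       ≈⟨ interchange _ _ _ _ ⟩
      (∑≤ n f + f (suc n)) + (∑≤ n g + g (suc n))       ∎
      where open import Algebra.Properties.CommutativeSemigroup +-commutativeSemigroup using (interchange)

    *-distribˡ-∑≤ : ∀ n a f → a * ∑≤ n f ≈ ∑≤ n (λ i → a * f i)
    *-distribˡ-∑≤ zero    a f = refl
    *-distribˡ-∑≤ (suc n) a f = distribˡ a (∑≤ n f) (f (suc n)) ⟨ trans ⟩ +-congʳ (*-distribˡ-∑≤ n a f)

    *-distribʳ-∑≤ : ∀ n a f → ∑≤ n f * a ≈ ∑≤ n (λ i → f i * a)
    *-distribʳ-∑≤ zero    a f = refl
    *-distribʳ-∑≤ (suc n) a f = distribʳ a (∑≤ n f) (f (suc n)) ⟨ trans ⟩ +-congʳ (*-distribʳ-∑≤ n a f)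

    ∑≤-zero : ∀ n {f} → (∀ i → f i ≈ 0#) → ∑≤ n f ≈ 0#
    ∑≤-zero zero    f≈0 = f≈0 0
    ∑≤-zero (suc n) f≈0 = +-cong (∑≤-zero n f≈0) (f≈0 (suc n)) ⟨ trans ⟩ +-identityˡ 0#

    ∑≤-head : ∀ n f → ∑≤ (suc n) f ≈ f 0 + ∑≤ n (λ i → f (suc i))
    ∑≤-head zero    f = refl
    ∑≤-head (suc n) f = +-congʳ (∑≤-head n f) ⟨ trans ⟩ +-assoc _ _ _

    ∑≤-reverse : ∀ n f → ∑≤ n f ≈ ∑≤ n (λ i → f (n ∸ i))
    ∑≤-reverse zero    f = refl
    ∑≤-reverse (suc n) f = begin
      ∑≤ n f + f (suc n)                   ≈⟨ +-comm _ _ ⟩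
      f (suc n) + ∑≤ n f                   ≈⟨ +-congˡ (∑≤-reverse n f) ⟩
      f (suc n) + ∑≤ n (λ i → f (n ∸ i))   ≈⟨ ∑≤-head n (λ i → f (suc n ∸ i)) ⟨
      ∑≤ (suc n) (λ i → f (suc n ∸ i))     ∎

    ∑≤-triangle : ∀ n (g : ℕ → ℕ → Carrier) →
                  ∑≤ n (λ k → ∑≤ k (λ i → g i (k ∸ i))) ≈ ∑≤ n (λ i → ∑≤ (n ∸ i) (g i))
    ∑≤-triangle zero    g = refl
    ∑≤-triangle (suc n) g = begin
      ∑≤ n (λ k → ∑≤ k (λ i → g i (k ∸ i))) + ∑≤ (suc n) (λ i → g i (suc n ∸ i))
        ≈⟨ +-congʳ (∑≤-triangle n g) ⟩
      ∑≤ n (λ i → ∑≤ (n ∸ i) (g i)) + (∑≤ n (λ i → g i (suc n ∸ i)) + g (suc n) (n ∸ n))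
        ≈⟨ +-assoc _ _ _ ⟨
      ∑≤ n (λ i → ∑≤ (n ∸ i) (g i)) + ∑≤ n (λ i → g i (suc n ∸ i)) + g (suc n) (n ∸ n)
        ≈⟨ +-congʳ (∑≤-distrib-+ n _ _) ⟨
      ∑≤ n (λ i → ∑≤ (n ∸ i) (g i) + g i (suc n ∸ i)) + g (suc n) (n ∸ n)
        ≈⟨ +-cong (∑≤-cong-≤ n longer) last ⟩
      ∑≤ n (λ i → ∑≤ (suc n ∸ i) (g i)) + ∑≤ (suc n ∸ suc n) (g (suc n))
        ∎
      where
      longer : ∀ {i} → i ≤ n → ∑≤ (n ∸ i) (g i) + g i (suc n ∸ i) ≈ ∑≤ (suc n ∸ i) (g i)
      longer i≤n rewrite ℕ.+-∸-assoc 1 i≤n = refl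
      last : g (suc n) (n ∸ n) ≈ ∑≤ (n ∸ n) (g (suc n))
      last rewrite ℕ.n∸n≡0 n = refl

    PowerSeries : Set c
    PowerSeries = ℕ → Carrier

    infix  4 _≈ˢ_
    infixl 6 _+ˢ_
    infixl 7 _*ˢ_

    _≈ˢ_ : PowerSeries → PowerSeries → Set ℓ
    A ≈ˢ B = ∀ n → A n ≈ B n

    _+ˢ_ : PowerSeries → PowerSeries → PowerSeries
    (A +ˢ B) n = A n + B n

    _*ˢ_ : PowerSeries → PowerSeries → PowerSeries
    (A *ˢ B) n = ∑≤ n (λ i → A i * B (n ∸ i))

    -ˢ_ : PowerSeries → PowerSeries
    (-ˢ A) n = - A n

    C : Carrier → PowerSeries
    C a zero    = a
    C a (suc n) = 0#

    X : PowerSeries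
    X zero    = 0#
    X (suc n) = C 1# n

    *ˢ-cong : ∀ {A A′ B B′} → A ≈ˢ A′ → B ≈ˢ B′ → A *ˢ B ≈ˢ A′ *ˢ B′
    *ˢ-cong A≈A′ B≈B′ n = ∑≤-cong n (λ i → *-cong (A≈A′ i) (B≈B′ (n ∸ i)))

    *ˢ-comm : ∀ A B → A *ˢ B ≈ˢ B *ˢ A
    *ˢ-comm A B n = ∑≤-reverse n _ ⟨ trans ⟩ ∑≤-cong-≤ n swap
      where
      swap : ∀ {i} → i ≤ n → A (n ∸ i) * B (n ∸ (n ∸ i)) ≈ B i * A (n ∸ i)
      swap i≤n rewrite ℕ.m∸[m∸n]≡n i≤n = *-comm _ _

    *ˢ-assoc : ∀ A B C → (A *ˢ B) *ˢ C ≈ˢ A *ˢ (B *ˢ C)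
    *ˢ-assoc A B C n = begin
      ∑≤ n (λ k → ∑≤ k (λ i → A i * B (k ∸ i)) * C (n ∸ k))
        ≈⟨ ∑≤-cong n (λ k → *-distribʳ-∑≤ k _ _) ⟩
      ∑≤ n (λ k → ∑≤ k (λ i → A i * B (k ∸ i) * C (n ∸ k)))
        ≈⟨ ∑≤-cong n (λ k → ∑≤-cong-≤ k (λ {i} i≤k → reassociate i≤k)) ⟩
      ∑≤ n (λ k → ∑≤ k (λ i → A i * (B (k ∸ i) * C (n ∸ i ∸ (k ∸ i)))))
        ≈⟨ ∑≤-triangle n (λ i j → A i * (B j * C (n ∸ i ∸ j))) ⟩
      ∑≤ n (λ i → ∑≤ (n ∸ i) (λ j → A i * (B j * C (n ∸ i ∸ j))))
        ≈⟨ ∑≤-cong n (λ i → *-distribˡ-∑≤ (n ∸ i) (A i) _) ⟨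
      ∑≤ n (λ i → A i * ∑≤ (n ∸ i) (λ j → B j * C (n ∸ i ∸ j)))
        ∎
      where
      reassociate : ∀ {i k} → i ≤ k → A i * B (k ∸ i) * C (n ∸ k) ≈ A i * (B (k ∸ i) * C (n ∸ i ∸ (k ∸ i)))
      reassociate {i} {k} i≤k rewrite ℕ.∸-+-assoc n i (k ∸ i) | ℕ.m+[n∸m]≡n i≤k = *-assoc _ _ _

    *ˢ-distribˡ-+ˢ : ∀ A B C → A *ˢ (B +ˢ C) ≈ˢ A *ˢ B +ˢ A *ˢ C
    *ˢ-distribˡ-+ˢ A B C n = ∑≤-cong n (λ i → distribˡ (A i) _ _) ⟨ trans ⟩ ∑≤-distrib-+ n _ _

    C-*ˢ : ∀ a B n → (C a *ˢ B) n ≈ a * B n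
    C-*ˢ a B zero    = refl
    C-*ˢ a B (suc n) = ∑≤-head n _ ⟨ trans ⟩ (+-congˡ (∑≤-zero n (λ _ → zeroˡ _)) ⟨ trans ⟩ +-identityʳ _)

    X-*ˢ-zero : ∀ B → (X *ˢ B) 0 ≈ 0#
    X-*ˢ-zero B = zeroˡ _

    X-*ˢ-suc : ∀ B n → (X *ˢ B) (suc n) ≈ B n
    X-*ˢ-suc B n = ∑≤-head n _ ⟨ trans ⟩ (+-congʳ (zeroˡ _) ⟨ trans ⟩ (+-identityˡ _ ⟨ trans ⟩ C-*ˢ 1# B n ⟨ trans ⟩ *-identityˡ _))

    isCommutativeRingˢ : IsCommutativeRing _≈ˢ_ _+ˢ_ _*ˢ_ -ˢ_ (λ _ → 0#) (C 1#)
    isCommutativeRingˢ = record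
      { isRing = record
        { +-isAbelianGroup = record
          { isGroup = record
            { isMonoid = record
              { isSemigroup = record
                { isMagma = record
                  { isEquivalence = record
                    { refl = λ n → refl ; sym = λ p n → sym (p n) ; trans = λ p q n → trans (p n) (q n) }
                  ; ∙-cong = λ p q n → +-cong (p n) (q n) }
                ; assoc = λ A B C n → +-assoc (A n) (B n) (C n) }
              ; identity = (λ A n → +-identityˡ (A n)) , (λ A n → +-identityʳ (A n)) }
            ; inverse = (λ A n → -‿inverseˡ (A n)) , (λ A n → -‿inverseʳ (A n))
            ; ⁻¹-cong = λ p n → -‿cong (p n) }
          ; comm = λ A B n → +-comm (A n) (B n) }
        ; *-cong = *ˢ-cong
        ; *-assoc = *ˢ-assoc
        ; *-identity = (λ A n → C-*ˢ 1# A n ⟨ trans ⟩ *-identityˡ (A n))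
                     , (λ A n → *ˢ-comm A (C 1#) n ⟨ trans ⟩ (C-*ˢ 1# A n ⟨ trans ⟩ *-identityˡ (A n)))
        ; distrib = *ˢ-distribˡ-+ˢ
                  , (λ A B C n → *ˢ-comm (B +ˢ C) A n ⟨ trans ⟩ (*ˢ-distribˡ-+ˢ A B C n ⟨ trans ⟩ +-cong (*ˢ-comm A B n) (*ˢ-comm A C n))) }
      ; *-comm = *ˢ-comm }

    commutativeRingˢ : CommutativeRing c ℓ
    commutativeRingˢ = record { isCommutativeRing = isCommutativeRingˢ }

    ∑≤-apply : ∀ n (G : ℕ → PowerSeries) m → sum≤ _+ˢ_ n G m ≈ ∑≤ n (λ i → G i m)
    ∑≤-apply zero    G m = refl
    ∑≤-apply (suc n) G m = +-congʳ (∑≤-apply n G m)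

module FourVariableSeries where

  open FormalPowerSeries
  open import Level using (0ℓ)
  open import Algebra.Bundles using (CommutativeRing)
  open import Algebra.Structures using (IsCommutativeRing)
  open import Data.Nat as ℕ using (ℕ; zero; suc; _∸_; _<_; s≤s)
  open import Data.Rational as ℚ using (ℚ; 0ℚ; 1ℚ)
  import Data.Rational.Properties as ℚ
  open import Relation.Binary.PropositionalEquality as ≡ using (_≡_; refl; cong; cong₂)
  open import Defs

  shift : (ℕ → ℚ) → ℕ → ℚ
  shift F zero    = 0ℚ
  shift F (suc k) = F k

  shiftBy : ℕ → (ℕ → ℚ) → ℕ → ℚ
  shiftBy zero    F = F
  shiftBy (suc m) F = shift (shiftBy m F)

  shiftBy-< : ∀ m F e → e < m → shiftBy m F e ≡ 0ℚ
  shiftBy-< (suc m) F zero    _         = refl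
  shiftBy-< (suc m) F (suc e) (s≤s e<m) = shiftBy-< m F e e<m

  shiftBy-+ : ∀ m F e → shiftBy m F (m ℕ.+ e) ≡ F e
  shiftBy-+ zero    F e = refl
  shiftBy-+ (suc m) F e = shiftBy-+ m F e

  -- Series is definitionally the iterated power series ring ℚ[[α]][[y]][[x]][[z]]:
  -- a series is a function from the exponent of z to ℚ[[α]][[y]][[x]], and so on inwards.
  module Pα = PowerSeries ℚ.+-*-commutativeRing
  module Py = PowerSeries Pα.commutativeRingˢ
  module Px = PowerSeries Py.commutativeRingˢ
  module Pz = PowerSeries Px.commutativeRingˢ

  Σ≤-as-sum≤ : ∀ n g → Σ≤ n g ≡ sum≤ ℚ._+_ n g
  Σ≤-as-sum≤ zero    g = refl
  Σ≤-as-sum≤ (suc n) g = cong (ℚ._+ g (suc n)) (Σ≤-as-sum≤ n g)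

  Σ≤-cong : ∀ n {f g : ℕ → ℚ} → (∀ i → f i ≡ g i) → Σ≤ n f ≡ Σ≤ n g
  Σ≤-cong zero    f≡g = f≡g 0
  Σ≤-cong (suc n) f≡g = cong₂ ℚ._+_ (Σ≤-cong n f≡g) (f≡g (suc n))

  *ˢ-coeffα : ∀ A B e → (A Pα.*ˢ B) e ≡ Σ≤ e λ l → A l ℚ.* B (e ∸ l)
  *ˢ-coeffα A B e = ≡.sym (Σ≤-as-sum≤ e _)

  *ˢ-coeffy : ∀ A B d e → (A Py.*ˢ B) d e ≡ Σ≤ d λ k → Σ≤ e λ l → A k l ℚ.* B (d ∸ k) (e ∸ l)
  *ˢ-coeffy A B d e = ≡.trans (Pα.∑≤-apply d _ e) (≡.trans (≡.sym (Σ≤-as-sum≤ d _))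
    (Σ≤-cong d λ k → *ˢ-coeffα (A k) (B (d ∸ k)) e))

  *ˢ-coeffx : ∀ A B c d e →
              (A Px.*ˢ B) c d e ≡ Σ≤ c λ j → Σ≤ d λ k → Σ≤ e λ l → A j k l ℚ.* B (c ∸ j) (d ∸ k) (e ∸ l)
  *ˢ-coeffx A B c d e = ≡.trans (Py.∑≤-apply c _ d e) (≡.trans (Pα.∑≤-apply c _ e) (≡.trans (≡.sym (Σ≤-as-sum≤ c _))
    (Σ≤-cong c λ j → *ˢ-coeffy (A j) (B (c ∸ j)) d e)))

  ⊛-as-*ˢ : ∀ A B → A ⊛ B ≋ A Pz.*ˢ B
  ⊛-as-*ˢ A B n c d e = ≡.sym (≡.trans (Px.∑≤-apply n _ c d e) (≡.trans (Py.∑≤-apply n _ d e)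
    (≡.trans (Pα.∑≤-apply n _ e) (≡.trans (≡.sym (Σ≤-as-sum≤ n _))
    (Σ≤-cong n λ i → *ˢ-coeffx (A i) (B (n ∸ i)) c d e)))))

  𝟙-as-1ˢ : 𝟙 ≋ Pz.C (Px.C (Py.C (Pα.C 1ℚ)))
  𝟙-as-1ˢ zero    zero    zero    zero    = refl
  𝟙-as-1ˢ zero    zero    zero    (suc e) = refl
  𝟙-as-1ˢ zero    zero    (suc d) e       = refl
  𝟙-as-1ˢ zero    (suc c) d       e       = refl
  𝟙-as-1ˢ (suc n) c       d       e       = refl

  z-as-X : z ≋ Pz.X
  z-as-X zero          c       d       e       = refl
  z-as-X (suc zero)    zero    zero    zero    = refl
  z-as-X (suc zero)    zero    zero    (suc e) = refl
  z-as-X (suc zero)    zero    (suc d) e       = refl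
  z-as-X (suc zero)    (suc c) d       e       = refl
  z-as-X (suc (suc n)) c       d       e       = refl

  x-as-X : x ≋ Pz.C Px.X
  x-as-X zero    zero          d       e       = refl
  x-as-X zero    (suc zero)    zero    zero    = refl
  x-as-X zero    (suc zero)    zero    (suc e) = refl
  x-as-X zero    (suc zero)    (suc d) e       = refl
  x-as-X zero    (suc (suc c)) d       e       = refl
  x-as-X (suc n) c             d       e       = refl

  y-as-X : y ≋ Pz.C (Px.C Py.X)
  y-as-X zero    zero    zero          e       = refl
  y-as-X zero    zero    (suc zero)    zero    = refl
  y-as-X zero    zero    (suc zero)    (suc e) = refl
  y-as-X zero    zero    (suc (suc d)) e       = refl
  y-as-X zero    (suc c) d             e       = refl
  y-as-X (suc n) c       d             e       = refl

  α-as-X : α ≋ Pz.C (Px.C (Py.C Pα.X))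
  α-as-X zero    zero    zero    zero          = refl
  α-as-X zero    zero    zero    (suc zero)    = refl
  α-as-X zero    zero    zero    (suc (suc e)) = refl
  α-as-X zero    zero    (suc d) e             = refl
  α-as-X zero    (suc c) d       e             = refl
  α-as-X (suc n) c       d       e             = refl

  -- The ring operations are opaque so that ring reasoning and unification treat
  -- products of series as atoms instead of unfolding convolutions.
  opaque
    infixl 6 _⊞_
    infixl 7 _⊠_
    _⊞_ _⊠_ : Series → Series → Series
    _⊞_ = Pz._+ˢ_
    _⊠_ = Pz._*ˢ_

    ⊟_ : Series → Series
    ⊟_ = Pz.-ˢ_

    0ˢ 1ˢ : Series
    0ˢ _ _ _ _ = 0ℚ
    1ˢ = Pz.C (Px.C (Py.C (Pα.C 1ℚ)))

  opaque
    unfolding _⊞_ _⊠_ ⊟_ 0ˢ 1ˢ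

    𝕊-isCommutativeRing : IsCommutativeRing _≋_ _⊞_ _⊠_ ⊟_ 0ˢ 1ˢ
    𝕊-isCommutativeRing = Pz.isCommutativeRingˢ

  𝕊 : CommutativeRing 0ℓ 0ℓ
  𝕊 = record { isCommutativeRing = 𝕊-isCommutativeRing }

  open CommutativeRing 𝕊 public
    using (_+_; _*_; -_; _-_; 1#; semiring)
  open import Algebra.Properties.Semiring.Exp semiring public
    using (^-homo-*) renaming (_^_ to _^ˢ_)

  opaque
    unfolding _⊞_ _⊠_ ⊟_ 0ˢ 1ˢ

    ⊛-as-* : ∀ A B → A ⊛ B ≋ A * B
    ⊛-as-* = ⊛-as-*ˢ

    ⊕-as-+ : ∀ A B → A ⊕ B ≋ A + B
    ⊕-as-+ A B n c d e = refl

    ⊖-as-- : ∀ A B → A ⊖ B ≋ A - B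
    ⊖-as-- A B n c d e = refl

    𝟙-as-1# : 𝟙 ≋ 1#
    𝟙-as-1# = 𝟙-as-1ˢ

    +-coeff : ∀ A B n c d e → (A + B) n c d e ≡ A n c d e ℚ.+ B n c d e
    +-coeff A B n c d e = refl

    neg-coeff : ∀ A n c d e → (- A) n c d e ≡ ℚ.- A n c d e
    neg-coeff A n c d e = refl

    z*-coeff : ∀ B n c d e → (z * B) n c d e ≡ shift (λ n′ → B n′ c d e) n
    z*-coeff B n c d e = ≡.trans (Pz.*ˢ-cong {B = B} {B′ = B} z-as-X (λ _ _ _ _ → refl) n c d e) (go n)
      where
      go : ∀ n → (Pz.X Pz.*ˢ B) n c d e ≡ shift (λ n′ → B n′ c d e) n
      go zero    = Pz.X-*ˢ-zero B c d e
      go (suc n) = Pz.X-*ˢ-suc B n c d e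

    x*-coeff : ∀ B n c d e → (x * B) n c d e ≡ shift (λ c′ → B n c′ d e) c
    x*-coeff B n c d e = ≡.trans (Pz.*ˢ-cong {B = B} {B′ = B} x-as-X (λ _ _ _ _ → refl) n c d e)
      (≡.trans (Pz.C-*ˢ Px.X B n c d e) (go c))
      where
      go : ∀ c → (Px.X Px.*ˢ B n) c d e ≡ shift (λ c′ → B n c′ d e) c
      go zero    = Px.X-*ˢ-zero (B n) d e
      go (suc c) = Px.X-*ˢ-suc (B n) c d e

    y*-coeff : ∀ B n c d e → (y * B) n c d e ≡ shift (λ d′ → B n c d′ e) d
    y*-coeff B n c d e = ≡.trans (Pz.*ˢ-cong {B = B} {B′ = B} y-as-X (λ _ _ _ _ → refl) n c d e)
      (≡.trans (Pz.C-*ˢ _ B n c d e) (≡.trans (Px.C-*ˢ Py.X (B n) c d e) (go d)))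
      where
      go : ∀ d → (Py.X Py.*ˢ B n c) d e ≡ shift (λ d′ → B n c d′ e) d
      go zero    = Py.X-*ˢ-zero (B n c) e
      go (suc d) = Py.X-*ˢ-suc (B n c) d e

    α*-coeff : ∀ B n c d e → (α * B) n c d e ≡ shift (λ e′ → B n c d e′) e
    α*-coeff B n c d e = ≡.trans (Pz.*ˢ-cong {B = B} {B′ = B} α-as-X (λ _ _ _ _ → refl) n c d e)
      (≡.trans (Pz.C-*ˢ _ B n c d e) (≡.trans (Px.C-*ˢ _ (B n) c d e) (≡.trans (Py.C-*ˢ Pα.X (B n c) d e) (go e))))
      where
      go : ∀ e → (Pα.X Pα.*ˢ B n c d) e ≡ shift (λ e′ → B n c d e′) e
      go zero    = Pα.X-*ˢ-zero (B n c d)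
      go (suc e) = Pα.X-*ˢ-suc (B n c d) e

  shift-cong : ∀ {F G} → (∀ i → F i ≡ G i) → ∀ k → shift F k ≡ shift G k
  shift-cong F≡G zero    = refl
  shift-cong F≡G (suc k) = F≡G k

  module _ where
    open CommutativeRing 𝕊 using (ring; sym; trans; +-cong; *-cong; -‿cong; *-assoc; *-identityˡ)
    open import Algebra.Properties.Ring ring using (-‿distribˡ-*)

    ⊕⇒+ : ∀ {A A′ B B′} → A ≋ A′ → B ≋ B′ → A ⊕ B ≋ A′ + B′
    ⊕⇒+ A≈ B≈ = trans (⊕-as-+ _ _) (+-cong A≈ B≈)

    ⊛⇒* : ∀ {A A′ B B′} → A ≋ A′ → B ≋ B′ → A ⊛ B ≋ A′ * B′
    ⊛⇒* A≈ B≈ = trans (⊛-as-* _ _) (*-cong A≈ B≈)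

    ⊖⇒- : ∀ {A A′ B B′} → A ≋ A′ → B ≋ B′ → A ⊖ B ≋ A′ - B′
    ⊖⇒- A≈ B≈ = trans (⊖-as-- _ _) (+-cong A≈ (-‿cong B≈))

    ^⇒^ : ∀ {A A′} k → A ≋ A′ → A ^ k ≋ A′ ^ˢ k
    ^⇒^ zero    A≈ = 𝟙-as-1#
    ^⇒^ (suc k) A≈ = ⊛⇒* A≈ (^⇒^ k A≈)

    α^*-coeff : ∀ m B n c d e → (α ^ˢ m * B) n c d e ≡ shiftBy m (λ e′ → B n c d e′) e
    α^*-coeff zero    B n c d e = *-identityˡ B n c d e
    α^*-coeff (suc m) B n c d e = ≡.trans (*-assoc α (α ^ˢ m) B n c d e) (≡.trans (α*-coeff _ n c d e) (go e))
      where
      go : ∀ e → shift (λ e′ → (α ^ˢ m * B) n c d e′) e ≡ shiftBy (suc m) (λ e′ → B n c d e′) e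
      go zero    = refl
      go (suc e) = α^*-coeff m B n c d e

    neg*-coeff : ∀ A B n c d e → ((- A) * B) n c d e ≡ ℚ.- (A * B) n c d e
    neg*-coeff A B n c d e = ≡.trans (sym (-‿distribˡ-* A B) n c d e) (neg-coeff (A * B) n c d e)

module Recurrences where

  open FourVariableSeries
  open import Defs using (Series; _≋_; x; y; z; α)
  open import Data.Nat using (ℕ; zero; suc)
  open import Algebra.Bundles using (CommutativeRing)
  open CommutativeRing 𝕊
    using (setoid; refl; sym; trans; +-congˡ; *-congˡ; *-congʳ; commutativeSemiring; ring)
  open import Algebra.Properties.Ring ring using (-‿distribˡ-*)
  open import Algebra.Solver.Ring.NaturalCoefficients.Default commutativeSemiring
    using (solve; _:=_; _:+_; _:*_; con)
  open import Data.Rational as ℚ using (ℚ)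
  import Data.Rational.Properties as ℚ
  open import Algebra.Properties.Group ℚ.+-0-group using (∙-cancelʳ)
  open import Relation.Binary.PropositionalEquality as ≡ using (_≡_; cong; cong₂)

  -- If U j = V * w ^ j, then Φ U j = V * (1 + x w) (1 - α w²) * w ^ j.
  Φ : (ℕ → Series) → ℕ → Series
  Φ U j = U j + x * U (suc j) + (- α) * (U (suc (suc j)) + x * U (suc (suc (suc j))))

  module _ (M : Series) where
    open import Relation.Binary.Reasoning.Setoid setoid

    powers-rec : M ≋ 1# + (x + y) * z * M + α * z ^ˢ 2 * M ^ˢ 2 →
                 ∀ j → (z * M) ^ˢ suc j ≋ z * ((z * M) ^ˢ j + x * (z * M) ^ˢ suc j + y * (z * M) ^ˢ suc j + α * (z * M) ^ˢ suc (suc j))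
    powers-rec M-eq j = begin
      z * M * W                                                              ≈⟨ *-congʳ (*-congˡ M-eq) ⟩
      z * (1# + (x + y) * z * M + α * (z * (z * 1#)) * (M * (M * 1#))) * W  ≈⟨ expand z x y α M W ⟩
      z * (W + x * (z * M * W) + y * (z * M * W) + α * (z * M * (z * M * W))) ∎
      where
      W : Series
      W = (z * M) ^ˢ j
      expand : ∀ z x y a m w → z * (1# + (x + y) * z * m + a * (z * (z * 1#)) * (m * (m * 1#))) * w
                               ≋ z * (w + x * (z * m * w) + y * (z * m * w) + a * (z * m * (z * m * w)))
      expand = solve 6 (λ z x y a m w →
        z :* (con 1 :+ (x :+ y) :* z :* m :+ a :* (z :* (z :* con 1)) :* (m :* (m :* con 1))) :* w
        := z :* (w :+ x :* (z :* m :* w) :+ y :* (z :* m :* w) :+ a :* (z :* m :* (z :* m :* w)))) refl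

    Φ-powers : ∀ L R → L * ((1# + x * z * M) * (1# - α * z ^ˢ 2 * M ^ˢ 2)) ≋ R →
               ∀ j → Φ (λ i → L * (z * M) ^ˢ i) j ≋ R * (z * M) ^ˢ j
    Φ-powers L R L-eq j = begin
      L * W + x * (L * (w * W)) + (- α) * (L * (w * (w * W)) + x * (L * (w * (w * (w * W)))))
        ≈⟨ expand L x (- α) z M W ⟩
      L * ((1# + x * z * M) * (1# + (- α) * (z * (z * 1#)) * (M * (M * 1#)))) * W
        ≈⟨ *-congʳ (*-congˡ (*-congˡ (+-congˡ negate-α))) ⟩
      L * ((1# + x * z * M) * (1# - α * z ^ˢ 2 * M ^ˢ 2)) * W
        ≈⟨ *-congʳ L-eq ⟩
      R * W ∎
      where
      w W : Series
      w = z * M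
      W = w ^ˢ j
      negate-α : (- α) * z ^ˢ 2 * M ^ˢ 2 ≋ - (α * z ^ˢ 2 * M ^ˢ 2)
      negate-α = trans (*-congʳ (sym (-‿distribˡ-* α _))) (sym (-‿distribˡ-* _ _))
      expand : ∀ l x a z m w → l * w + x * (l * (z * m * w)) + a * (l * (z * m * (z * m * w)) + x * (l * (z * m * (z * m * (z * m * w)))))
                               ≋ l * ((1# + x * z * m) * (1# + a * (z * (z * 1#)) * (m * (m * 1#)))) * w
      expand = solve 6 (λ l x a z m w →
        l :* w :+ x :* (l :* (z :* m :* w)) :+ a :* (l :* (z :* m :* (z :* m :* w)) :+ x :* (l :* (z :* m :* (z :* m :* (z :* m :* w)))))
        := l :* ((con 1 :+ x :* z :* m) :* (con 1 :+ a :* (z :* (z :* con 1)) :* (m :* (m :* con 1)))) :* w) refl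

  Φ-linear : ∀ a b U V j → Φ (λ i → a * U i + b * V i) j ≋ a * Φ U j + b * Φ V j
  Φ-linear a b U V j = solve 12 (λ a b x a′ u₀ u₁ u₂ u₃ v₀ v₁ v₂ v₃ →
    a :* u₀ :+ b :* v₀ :+ x :* (a :* u₁ :+ b :* v₁) :+ a′ :* (a :* u₂ :+ b :* v₂ :+ x :* (a :* u₃ :+ b :* v₃))
    := a :* (u₀ :+ x :* u₁ :+ a′ :* (u₂ :+ x :* u₃)) :+ b :* (v₀ :+ x :* v₁ :+ a′ :* (v₂ :+ x :* v₃))) refl
    a b x (- α) (U j) (U (suc j)) (U (suc (suc j))) (U (suc (suc (suc j))))
    (V j) (V (suc j)) (V (suc (suc j))) (V (suc (suc (suc j))))

  Φ-coeff : ∀ U j n c d e → Φ U j n c d e ≡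
            U j n c d e ℚ.+ shift (λ c′ → U (suc j) n c′ d e) c
              ℚ.- shift (λ e′ → U (suc (suc j)) n c d e′ ℚ.+ shift (λ c′ → U (suc (suc (suc j))) n c′ d e′) c) e
  Φ-coeff U j n c d e = ≡.trans (+-coeff _ _ n c d e) (cong₂ ℚ._+_
    (≡.trans (+-coeff _ _ n c d e) (cong (U j n c d e ℚ.+_) (x*-coeff _ n c d e)))
    (≡.trans (neg*-coeff α _ n c d e) (cong ℚ.-_ (≡.trans (α*-coeff _ n c d e)
      (shift-cong (λ e′ → ≡.trans (+-coeff _ _ n c d e′) (cong (U (suc (suc j)) n c d e′ ℚ.+_) (x*-coeff _ n c d e′))) e)))))

  -- The coefficient of x^c α^e in Φ U j is that of U j plus coefficients of later members of U
  -- at strictly smaller (c, e); so induct on (c, e) lexicographically, for all j at once.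
  Φ-injective : ∀ U V → (∀ j → Φ U j ≋ Φ V j) → ∀ j → U j ≋ V j
  Φ-injective U V ΦU≋ΦV j n c d e = go c e j
    where
    go : ∀ c e j → U j n c d e ≡ V j n c d e
    go c e j = ∙-cancelʳ _ _ _ (∙-cancelʳ _ _ _ (begin
        U j n c d e ℚ.+ a V ℚ.- b V   ≡⟨ cong₂ (λ p q → U j n c d e ℚ.+ p ℚ.- q) (≡.sym (a-eq c)) (≡.sym (b-eq e)) ⟩
        U j n c d e ℚ.+ a U ℚ.- b U   ≡⟨ ≡.sym (Φ-coeff U j n c d e) ⟩
        Φ U j n c d e                 ≡⟨ ΦU≋ΦV j n c d e ⟩
        Φ V j n c d e                 ≡⟨ Φ-coeff V j n c d e ⟩
        V j n c d e ℚ.+ a V ℚ.- b V   ∎))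
      where
      open ≡.≡-Reasoning
      a b : (ℕ → Series) → ℚ
      a W = shift (λ c′ → W (suc j) n c′ d e) c
      b W = shift (λ e′ → W (suc (suc j)) n c d e′ ℚ.+ shift (λ c′ → W (suc (suc (suc j))) n c′ d e′) c) e
      a-eq : ∀ c → shift (λ c′ → U (suc j) n c′ d e) c ≡ shift (λ c′ → V (suc j) n c′ d e) c
      a-eq zero    = ≡.refl
      a-eq (suc c) = go c e (suc j)
      c-eq : ∀ c e → shift (λ c′ → U (suc (suc (suc j))) n c′ d e) c ≡ shift (λ c′ → V (suc (suc (suc j))) n c′ d e) c
      c-eq zero    e = ≡.refl
      c-eq (suc c) e = go c e (suc (suc (suc j)))
      b-eq : ∀ e → shift (λ e′ → U (suc (suc j)) n c d e′ ℚ.+ shift (λ c′ → U (suc (suc (suc j))) n c′ d e′) c) e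
                 ≡ shift (λ e′ → V (suc (suc j)) n c d e′ ℚ.+ shift (λ c′ → V (suc (suc (suc j))) n c′ d e′) c) e
      b-eq zero    = ≡.refl
      b-eq (suc e) = cong₂ ℚ._+_ (go c e (suc (suc j))) (c-eq c e)

module FactorialArithmetic where

  open import Data.Nat as ℕ using (ℕ; suc; _!; NonZero)
  import Data.Nat.Properties as ℕ
  open import Data.Nat.Properties using (_!≢0)
  open import Data.Integer as ℤ using (+_)
  import Data.Integer.Properties as ℤ
  open import Data.Rational as ℚ using (ℚ; _/_; 0ℚ; 1ℚ; fromℚᵘ)
  import Data.Rational.Properties as ℚ
  import Data.Rational.Unnormalised as ℚᵘ
  import Data.Rational.Unnormalised.Properties as ℚᵘ
  open import Relation.Binary.PropositionalEquality as ≡ using (_≡_; refl; cong; cong₂)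
  open import Defs using (invFact; recip)

  private
    fromℚᵘ-+ : ∀ p q → fromℚᵘ (p ℚᵘ.+ q) ≡ fromℚᵘ p ℚ.+ fromℚᵘ q
    fromℚᵘ-+ p q = ℚ.toℚᵘ-injective (ℚᵘ.≃-trans (ℚ.toℚᵘ-fromℚᵘ _) (ℚᵘ.≃-sym
      (ℚᵘ.≃-trans (ℚ.toℚᵘ-homo-+ (fromℚᵘ p) (fromℚᵘ q)) (ℚᵘ.+-cong (ℚ.toℚᵘ-fromℚᵘ p) (ℚ.toℚᵘ-fromℚᵘ q)))))

    fromℚᵘ-* : ∀ p q → fromℚᵘ (p ℚᵘ.* q) ≡ fromℚᵘ p ℚ.* fromℚᵘ q
    fromℚᵘ-* p q = ℚ.toℚᵘ-injective (ℚᵘ.≃-trans (ℚ.toℚᵘ-fromℚᵘ _) (ℚᵘ.≃-sym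
      (ℚᵘ.≃-trans (ℚ.toℚᵘ-homo-* (fromℚᵘ p) (fromℚᵘ q)) (ℚᵘ.*-cong (ℚ.toℚᵘ-fromℚᵘ p) (ℚ.toℚᵘ-fromℚᵘ q)))))

    /-≡ : ∀ a b c d .{{_ : NonZero b}} .{{_ : NonZero d}} → a ℕ.* d ≡ c ℕ.* b → + a / b ≡ + c / d
    /-≡ a b@(suc _) c d@(suc _) ad≡cb = ℚ.fromℚᵘ-cong {ℚᵘ.mkℚᵘ (+ a) _} {ℚᵘ.mkℚᵘ (+ c) _} (ℚᵘ.*≡*
      (≡.trans (≡.sym (ℤ.pos-* a d)) (≡.trans (cong +_ ad≡cb) (ℤ.pos-* c b))))

    /-* : ∀ a b c d .{{_ : NonZero b}} .{{_ : NonZero d}} →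
          (+ a / b) ℚ.* (+ c / d) ≡ (+ (a ℕ.* c) / (b ℕ.* d)) {{ℕ.m*n≢0 b d}}
    /-* a (suc b) c (suc d) = ≡.trans (≡.sym (fromℚᵘ-* (ℚᵘ.mkℚᵘ (+ a) b) (ℚᵘ.mkℚᵘ (+ c) d)))
      (cong (λ i → fromℚᵘ (ℚᵘ.mkℚᵘ i _)) (≡.sym (ℤ.pos-* a c)))

  -- Kept opaque so that unification and the rational solver treat these values as atoms.
  opaque
    fromℕ : ℕ → ℚ
    fromℕ n = + n / 1

    inv! : ℕ → ℚ
    inv! m = invFact (+ m)

    inv-suc : ℕ → ℚ
    inv-suc m = recip (+ suc m)

  opaque
    unfolding fromℕ inv! inv-suc

    fromℕ-def : ∀ n → fromℕ n ≡ + n / 1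
    fromℕ-def n = refl

    inv!-def : ∀ m → inv! m ≡ invFact (+ m)
    inv!-def m = refl

    inv-suc-def : ∀ m → inv-suc m ≡ recip (+ suc m)
    inv-suc-def m = refl

    fromℕ-0 : fromℕ 0 ≡ 0ℚ
    fromℕ-0 = refl

    fromℕ-1 : fromℕ 1 ≡ 1ℚ
    fromℕ-1 = refl

    inv!-0 : inv! 0 ≡ 1ℚ
    inv!-0 = refl

    inv!-1 : inv! 1 ≡ 1ℚ
    inv!-1 = refl

    fromℕ-+ : ∀ m n → fromℕ (m ℕ.+ n) ≡ fromℕ m ℚ.+ fromℕ n
    fromℕ-+ m n =
      ≡.trans (ℚ.fromℚᵘ-cong {ℚᵘ.mkℚᵘ (+ (m ℕ.+ n)) 0} {ℚᵘ.mkℚᵘ (+ m) 0 ℚᵘ.+ ℚᵘ.mkℚᵘ (+ n) 0} (ℚᵘ.*≡* eq))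
      (fromℚᵘ-+ (ℚᵘ.mkℚᵘ (+ m) 0) (ℚᵘ.mkℚᵘ (+ n) 0))
      where
      eq : + (m ℕ.+ n) ℤ.* + 1 ≡ (+ m ℤ.* + 1 ℤ.+ + n ℤ.* + 1) ℤ.* + 1
      eq = ≡.trans (ℤ.*-identityʳ _) (≡.trans (ℤ.pos-+ m n) (≡.sym (≡.trans (ℤ.*-identityʳ _)
             (cong₂ ℤ._+_ (ℤ.*-identityʳ (+ m)) (ℤ.*-identityʳ (+ n))))))

    fromℕ-* : ∀ m n → fromℕ (m ℕ.* n) ≡ fromℕ m ℚ.* fromℕ n
    fromℕ-* m n = ≡.sym (/-* m 1 n 1)

    inv!-suc : ∀ m → inv! m ≡ fromℕ (suc m) ℚ.* inv! (suc m)
    inv!-suc m = ≡.sym (≡.trans (/-* (suc m) 1 1 (suc m !) {{_}} {{suc m !≢0}})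
      (/-≡ (suc m ℕ.* 1) (1 ℕ.* suc m !) 1 (m !) {{ℕ.m*n≢0 1 (suc m !) {{_}} {{suc m !≢0}}}} {{m !≢0}} eq))
      where
      eq : suc m ℕ.* 1 ℕ.* m ! ≡ 1 ℕ.* (1 ℕ.* suc m !)
      eq = ≡.trans (cong (ℕ._* m !) (ℕ.*-identityʳ (suc m))) (≡.sym (≡.trans (ℕ.*-identityˡ _) (ℕ.*-identityˡ _)))

    fromℕ-suc*inv-suc : ∀ m → fromℕ (suc m) ℚ.* inv-suc m ≡ 1ℚ
    fromℕ-suc*inv-suc m = ≡.trans (/-* (suc m) 1 1 (suc m)) (/-≡ (suc m ℕ.* 1) (1 ℕ.* suc m) 1 1 eq)
      where
      eq : suc m ℕ.* 1 ℕ.* 1 ≡ 1 ℕ.* (1 ℕ.* suc m)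
      eq = ≡.trans (ℕ.*-identityʳ _) (≡.trans (ℕ.*-identityʳ _) (≡.sym (≡.trans (ℕ.*-identityˡ _) (ℕ.*-identityˡ _))))

  fromℕ-suc : ∀ n → fromℕ (suc n) ≡ 1ℚ ℚ.+ fromℕ n
  fromℕ-suc n = ≡.trans (fromℕ-+ 1 n) (cong (ℚ._+ fromℕ n) fromℕ-1)

module PowerCoefficients where

  open FourVariableSeries using (shift)
  open FactorialArithmetic
  open import Defs using (Series; 𝟙)
  open import Data.Nat as ℕ using (ℕ; zero; suc; _∸_; _≟_; _!)
  import Data.Nat.Properties as ℕ
  open import Data.Nat.Tactic.RingSolver using (solve-∀)
  open import Data.Rational using (ℚ; 0ℚ; _+_; _*_)
  import Data.Rational.Properties as ℚ
  open import Data.Rational.Solver using (module +-*-Solver)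
  open import Data.Product using (_×_; _,_)
  open import Data.Empty using (⊥-elim)
  open import Relation.Nullary using (Dec; yes; no; ¬_)
  open import Relation.Binary.PropositionalEquality as ≡ using (_≡_; _≢_; refl; cong; cong₂)
  open +-*-Solver using (solve; _:+_; _:*_; _:=_)

  guard : ∀ {p} {P : Set p} → Dec P → ℚ → ℚ
  guard (yes _) v = v
  guard (no _)  _ = 0ℚ

  guard-yes : ∀ {p} {P : Set p} (P? : Dec P) → P → ∀ v → guard P? v ≡ v
  guard-yes (yes _) _ v = refl
  guard-yes (no ¬p) p v = ⊥-elim (¬p p)

  guard-no : ∀ {p} {P : Set p} (P? : Dec P) → ¬ P → ∀ v → guard P? v ≡ 0ℚ
  guard-no (yes p) ¬p v = ⊥-elim (¬p p)
  guard-no (no _)  _  v = refl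

  -- [z^n x^c y^d α^e] w^j vanishes unless n = degree j c d e.
  degree : ℕ → ℕ → ℕ → ℕ → ℕ
  degree j c d e = c ℕ.+ d ℕ.+ (e ℕ.+ e) ℕ.+ j

  degree-sucʲ : ∀ j c d e → degree (suc j) c d e ≡ suc (degree j c d e)
  degree-sucʲ j c d e = ℕ.+-suc _ j

  degree-sucᵈ : ∀ j c d e → degree j c (suc d) e ≡ suc (degree j c d e)
  degree-sucᵈ j c d e = cong (λ m → m ℕ.+ (e ℕ.+ e) ℕ.+ j) (ℕ.+-suc c d)

  degree-sucᵉ : ∀ j c d e → degree j c d (suc e) ≡ suc (degree (suc j) c d e)
  degree-sucᵉ = arith
    where
    arith : ∀ j c d e → c ℕ.+ d ℕ.+ (suc e ℕ.+ suc e) ℕ.+ j ≡ suc (c ℕ.+ d ℕ.+ (e ℕ.+ e) ℕ.+ suc j)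
    arith = solve-∀

  degree≡0 : ∀ j c d e → 0 ≡ degree j c d e → (c ≡ 0) × (d ≡ 0) × (e ≡ 0) × (j ≡ 0)
  degree≡0 zero    zero    zero    zero    _ = refl , refl , refl , refl
  degree≡0 (suc j) c       d       e       eq with () ← ≡.trans eq (degree-sucʲ j c d e)
  degree≡0 zero    (suc c) d       e       ()
  degree≡0 zero    zero    (suc d) e       eq with () ← ≡.trans eq (degree-sucᵈ 0 0 d e)
  degree≡0 zero    zero    zero    (suc e) eq with () ← ≡.trans eq (degree-sucᵉ 0 0 0 e)

  -- The coefficients of w ^ j, by Lagrange inversion.
  𝒲 : ℕ → Series
  𝒲 zero = 𝟙
  𝒲 (suc j) n c d e = guard (n ≟ suc (degree j c d e))
    (fromℕ (suc j) * fromℕ ((n ∸ 1) !) * inv! c * inv! d * inv! e * inv! (e ℕ.+ suc j))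

  𝒲-off : ∀ j n c d e → n ≢ degree j c d e → 𝒲 j n c d e ≡ 0ℚ
  𝒲-off zero    zero    zero    zero    zero    n≢ = ⊥-elim (n≢ refl)
  𝒲-off zero    zero    zero    zero    (suc e) n≢ = refl
  𝒲-off zero    zero    zero    (suc d) e       n≢ = refl
  𝒲-off zero    zero    (suc c) d       e       n≢ = refl
  𝒲-off zero    (suc n) c       d       e       n≢ = refl
  𝒲-off (suc j) n       c       d       e       n≢ = guard-no (n ≟ _) (λ deg → n≢ (≡.trans deg (≡.sym (degree-sucʲ j c d e)))) _

  private
    -- For N + 1 = degree j c d e, every term of the recurrence for 𝒲 (suc j) at z^(N+2)
    -- is a multiple of N! / (c! d! e! (e+j+1)!).
    weight : ℕ → ℕ → ℕ → ℕ → ℕ → ℚ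
    weight j N c d e = fromℕ (N !) * inv! c * inv! d * inv! e * inv! (e ℕ.+ suc j)

    zeroʳ-factor : ∀ a w → (a * fromℕ 0) * w ≡ 0ℚ
    zeroʳ-factor a w = ≡.trans (cong (λ o → (a * o) * w) fromℕ-0) (≡.trans (cong (_* w) (ℚ.*-zeroʳ a)) (ℚ.*-zeroˡ w))

    zeroˡ-factor : ∀ a w → (fromℕ 0 * a) * w ≡ 0ℚ
    zeroˡ-factor a w = ≡.trans (cong (λ o → (o * a) * w) fromℕ-0) (≡.trans (cong (_* w) (ℚ.*-zeroˡ a)) (ℚ.*-zeroˡ w))

    inv!-pred : ∀ {m k} → suc m ≡ k → inv! m ≡ fromℕ k * inv! k
    inv!-pred refl = inv!-suc _

    lhs-term : ∀ j N c d e → suc N ≡ degree j c d e →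
               𝒲 (suc j) (suc (suc N)) c d e ≡ (fromℕ (suc j) * fromℕ (suc N)) * weight j N c d e
    lhs-term j N c d e deg = ≡.trans (guard-yes (suc (suc N) ≟ _) (cong suc deg) _)
      (≡.trans (cong (λ f → fromℕ (suc j) * f * inv! c * inv! d * inv! e * inv! (e ℕ.+ suc j)) (fromℕ-* (suc N) (N !)))
        (solve 7 (λ a b f x y z u → a :* (b :* f) :* x :* y :* z :* u := (a :* b) :* (f :* x :* y :* z :* u)) refl
          (fromℕ (suc j)) (fromℕ (suc N)) (fromℕ (N !)) (inv! c) (inv! d) (inv! e) (inv! (e ℕ.+ suc j))))

    j-term : ∀ j N c d e → suc N ≡ degree j c d e →
             𝒲 j (suc N) c d e ≡ (fromℕ j * fromℕ (e ℕ.+ suc j)) * weight j N c d e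
    j-term zero    N c d e deg = ≡.sym (zeroˡ-factor _ _)
    j-term (suc j) N c d e deg = ≡.trans (guard-yes (suc N ≟ _) (≡.trans deg (degree-sucʲ j c d e)) _)
      (≡.trans (cong (λ u → fromℕ (suc j) * fromℕ (N !) * inv! c * inv! d * inv! e * u) (inv!-pred (≡.sym (ℕ.+-suc e (suc j)))))
        (solve 7 (λ a b f x y z u → a :* f :* x :* y :* z :* (b :* u) := (a :* b) :* (f :* x :* y :* z :* u)) refl
          (fromℕ (suc j)) (fromℕ (e ℕ.+ suc (suc j))) (fromℕ (N !)) (inv! c) (inv! d) (inv! e) (inv! (e ℕ.+ suc (suc j)))))

    c-term : ∀ j N c d e → suc N ≡ degree j c d e →
             shift (λ c′ → 𝒲 (suc j) (suc N) c′ d e) c ≡ (fromℕ (suc j) * fromℕ c) * weight j N c d e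
    c-term j N zero    d e deg = ≡.sym (zeroʳ-factor (fromℕ (suc j)) (weight j N 0 d e))
    c-term j N (suc c) d e deg = ≡.trans (guard-yes (suc N ≟ _) deg _)
      (≡.trans (cong (λ x → fromℕ (suc j) * fromℕ (N !) * x * inv! d * inv! e * inv! (e ℕ.+ suc j)) (inv!-suc c))
        (solve 7 (λ a b f x y z u → a :* f :* (b :* x) :* y :* z :* u := (a :* b) :* (f :* x :* y :* z :* u)) refl
          (fromℕ (suc j)) (fromℕ (suc c)) (fromℕ (N !)) (inv! (suc c)) (inv! d) (inv! e) (inv! (e ℕ.+ suc j))))

    d-term : ∀ j N c d e → suc N ≡ degree j c d e →
             shift (λ d′ → 𝒲 (suc j) (suc N) c d′ e) d ≡ (fromℕ (suc j) * fromℕ d) * weight j N c d e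
    d-term j N c zero    e deg = ≡.sym (zeroʳ-factor (fromℕ (suc j)) (weight j N c 0 e))
    d-term j N c (suc d) e deg = ≡.trans (guard-yes (suc N ≟ _) (≡.trans deg (degree-sucᵈ j c d e)) _)
      (≡.trans (cong (λ y → fromℕ (suc j) * fromℕ (N !) * inv! c * y * inv! e * inv! (e ℕ.+ suc j)) (inv!-suc d))
        (solve 7 (λ a b f x y z u → a :* f :* x :* (b :* y) :* z :* u := (a :* b) :* (f :* x :* y :* z :* u)) refl
          (fromℕ (suc j)) (fromℕ (suc d)) (fromℕ (N !)) (inv! c) (inv! (suc d)) (inv! e) (inv! (e ℕ.+ suc j))))

    e-term : ∀ j N c d e → suc N ≡ degree j c d e →
             shift (λ e′ → 𝒲 (suc (suc j)) (suc N) c d e′) e ≡ (fromℕ (suc (suc j)) * fromℕ e) * weight j N c d e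
    e-term j N c d zero    deg = ≡.sym (zeroʳ-factor (fromℕ (suc (suc j))) (weight j N c d 0))
    e-term j N c d (suc e) deg = ≡.trans (guard-yes (suc N ≟ _) (≡.trans deg (degree-sucᵉ j c d e)) _)
      (≡.trans (cong₂ (λ z u → fromℕ (suc (suc j)) * fromℕ (N !) * inv! c * inv! d * z * inv! u) (inv!-suc e) (ℕ.+-suc e (suc j)))
        (solve 7 (λ a b f x y z u → a :* f :* x :* y :* (b :* z) :* u := (a :* b) :* (f :* x :* y :* z :* u)) refl
          (fromℕ (suc (suc j))) (fromℕ (suc e)) (fromℕ (N !)) (inv! c) (inv! d) (inv! (suc e)) (inv! (suc e ℕ.+ suc j))))

    degree-identity : ∀ j c d e → suc j ℕ.* (c ℕ.+ d ℕ.+ (e ℕ.+ e) ℕ.+ j)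
                      ≡ j ℕ.* (e ℕ.+ suc j) ℕ.+ suc j ℕ.* c ℕ.+ suc j ℕ.* d ℕ.+ suc (suc j) ℕ.* e
    degree-identity = solve-∀

    *-distribʳ-+₄ : ∀ a b c d w → (a + b + c + d) * w ≡ a * w + b * w + c * w + d * w
    *-distribʳ-+₄ = solve 5 (λ a b c d w → (a :+ b :+ c :+ d) :* w := a :* w :+ b :* w :+ c :* w :+ d :* w) refl

    fromℕ-+-* : ∀ a b c d e f g h → fromℕ (a ℕ.* b ℕ.+ c ℕ.* d ℕ.+ e ℕ.* f ℕ.+ g ℕ.* h)
                ≡ fromℕ a * fromℕ b + fromℕ c * fromℕ d + fromℕ e * fromℕ f + fromℕ g * fromℕ h
    fromℕ-+-* a b c d e f g h =
      ≡.trans (fromℕ-+ _ _) (cong₂ _+_ (≡.trans (fromℕ-+ _ _) (cong₂ _+_ (≡.trans (fromℕ-+ _ _)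
        (cong₂ _+_ (fromℕ-* a b) (fromℕ-* c d))) (fromℕ-* e f))) (fromℕ-* g h))

    𝒲-rec-off : ∀ j n c d e → n ≢ degree j c d e →
                𝒲 (suc j) (suc n) c d e ≡
                𝒲 j n c d e + shift (λ c′ → 𝒲 (suc j) n c′ d e) c + shift (λ d′ → 𝒲 (suc j) n c d′ e) d
                  + shift (λ e′ → 𝒲 (suc (suc j)) n c d e′) e
    𝒲-rec-off j n c d e n≢ = ≡.trans (guard-no (suc n ≟ _) (λ eq → n≢ (ℕ.suc-injective eq)) _)
      (≡.sym (≡.trans (cong₂ (λ p q → p + q + shift (λ d′ → 𝒲 (suc j) n c d′ e) d + shift (λ e′ → 𝒲 (suc (suc j)) n c d e′) e)
        (𝒲-off j n c d e n≢) (c-off c n≢)) (cong₂ (λ p q → 0ℚ + 0ℚ + p + q) (d-off d n≢) (e-off e n≢))))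
      where
      c-off : ∀ c → n ≢ degree j c d e → shift (λ c′ → 𝒲 (suc j) n c′ d e) c ≡ 0ℚ
      c-off zero    _  = refl
      c-off (suc c) n≢ = guard-no (n ≟ _) n≢ _
      d-off : ∀ d → n ≢ degree j c d e → shift (λ d′ → 𝒲 (suc j) n c d′ e) d ≡ 0ℚ
      d-off zero    _  = refl
      d-off (suc d) n≢ = guard-no (n ≟ _) (λ deg → n≢ (≡.trans deg (≡.sym (degree-sucᵈ j c d e)))) _
      e-off : ∀ e → n ≢ degree j c d e → shift (λ e′ → 𝒲 (suc (suc j)) n c d e′) e ≡ 0ℚ
      e-off zero    _  = refl
      e-off (suc e) n≢ = guard-no (n ≟ _) (λ deg → n≢ (≡.trans deg (≡.sym (degree-sucᵉ j c d e)))) _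

    𝒲-rec-on : ∀ j N c d e → suc N ≡ degree j c d e →
               𝒲 (suc j) (suc (suc N)) c d e ≡
               𝒲 j (suc N) c d e + shift (λ c′ → 𝒲 (suc j) (suc N) c′ d e) c + shift (λ d′ → 𝒲 (suc j) (suc N) c d′ e) d
                 + shift (λ e′ → 𝒲 (suc (suc j)) (suc N) c d e′) e
    𝒲-rec-on j N c d e deg = ≡.trans (lhs-term j N c d e deg) (≡.trans (cong (_* weight j N c d e) factor)
      (≡.trans (*-distribʳ-+₄ (fromℕ j * fromℕ (e ℕ.+ suc j)) (fromℕ (suc j) * fromℕ c) (fromℕ (suc j) * fromℕ d)
                               (fromℕ (suc (suc j)) * fromℕ e) (weight j N c d e))
        (≡.sym (cong₂ _+_ (cong₂ _+_ (cong₂ _+_ (j-term j N c d e deg) (c-term j N c d e deg)) (d-term j N c d e deg))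
                          (e-term j N c d e deg)))))
      where
      factor : fromℕ (suc j) * fromℕ (suc N)
               ≡ fromℕ j * fromℕ (e ℕ.+ suc j) + fromℕ (suc j) * fromℕ c + fromℕ (suc j) * fromℕ d + fromℕ (suc (suc j)) * fromℕ e
      factor = ≡.trans (≡.sym (fromℕ-* (suc j) (suc N)))
        (≡.trans (cong fromℕ (≡.trans (cong (suc j ℕ.*_) deg) (degree-identity j c d e))) (fromℕ-+-* _ _ _ _ _ _ _ _))

  𝒲-rec : ∀ j n c d e → 𝒲 (suc j) (suc n) c d e ≡
          𝒲 j n c d e + shift (λ c′ → 𝒲 (suc j) n c′ d e) c + shift (λ d′ → 𝒲 (suc j) n c d′ e) d
            + shift (λ e′ → 𝒲 (suc (suc j)) n c d e′) e
  𝒲-rec j n c d e with n ≟ degree j c d e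
  ... | no n≢ = 𝒲-rec-off j n c d e n≢
  ... | yes deg with n
  ...   | suc N = 𝒲-rec-on j N c d e deg
  ...   | zero with degree≡0 j c d e deg
  ...     | refl , refl , refl , refl rewrite fromℕ-1 | inv!-0 | inv!-1 = refl

module QuotientCoefficients where

  open FourVariableSeries using (shift)
  open FactorialArithmetic
  open PowerCoefficients
  open import Defs using (Series)
  open import Data.Nat as ℕ using (ℕ; zero; suc; _∸_; _≟_; _!)
  import Data.Nat.Properties as ℕ
  open import Data.Nat.Tactic.RingSolver using (solve-∀)
  open import Data.Rational using (ℚ; 0ℚ; 1ℚ; _+_; _-_; _*_)
  import Data.Rational.Properties as ℚ
  open import Data.Rational.Solver using (module +-*-Solver)
  open import Relation.Nullary.Decidable using (toSum)
  open import Data.Sum using ([_,_]′)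
  open import Relation.Binary.PropositionalEquality as ≡ using (_≡_; _≢_; refl; cong; cong₂)
  open +-*-Solver using (solve; _:+_; _:-_; _:*_; _:=_; con)

  -- The coefficients of w^(k+2) / ((1 + x w)(1 - α w²)).
  𝒫 : ℕ → Series
  𝒫 k n c d e = guard (n ≟ degree (suc (suc k)) c d e)
    (fromℕ ((n ∸ 1) !) * inv-suc (c ℕ.+ e ℕ.+ k) * inv! c * inv! d * inv! e * inv! (e ℕ.+ k))

  shift-+-shift : ∀ (A : ℕ → ℚ) (B : ℕ → ℕ → ℚ) c e →
                  shift (λ e′ → A e′ + shift (λ c′ → B c′ e′) c) e ≡ shift A e + shift (λ c′ → shift (B c′) e) c
  shift-+-shift A B zero    zero    = refl
  shift-+-shift A B (suc c) zero    = refl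
  shift-+-shift A B c       (suc e) = refl

  private
    inv-suc-split₀ : ∀ m → inv-suc m ≡ inv-suc m * (fromℕ (suc (suc m)) * inv-suc (suc m))
    inv-suc-split₀ m = ≡.sym (≡.trans (cong (inv-suc m *_) (fromℕ-suc*inv-suc (suc m))) (ℚ.*-identityʳ (inv-suc m)))

    inv-suc-split₁ : ∀ m → inv-suc (suc m) ≡ (fromℕ (suc m) * inv-suc m) * inv-suc (suc m)
    inv-suc-split₁ m = ≡.sym (≡.trans (cong (_* inv-suc (suc m)) (fromℕ-suc*inv-suc m)) (ℚ.*-identityˡ (inv-suc (suc m))))

    zero-middle : ∀ a b g → g * (a * fromℕ 0 * b) ≡ 0ℚ
    zero-middle a b g = ≡.trans (cong (λ o → g * (a * o * b)) fromℕ-0)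
      (≡.trans (cong (λ o → g * (o * b)) (ℚ.*-zeroʳ a)) (≡.trans (cong (g *_) (ℚ.*-zeroˡ b)) (ℚ.*-zeroʳ g)))

    zero-last : ∀ a b g → g * (a * b * fromℕ 0) ≡ 0ℚ
    zero-last a b g = ≡.trans (cong (λ o → g * (a * b * o)) fromℕ-0) (≡.trans (cong (g *_) (ℚ.*-zeroʳ (a * b))) (ℚ.*-zeroʳ g))

    -- With m = c+e+k, every term of the recurrence for 𝒫 is a multiple of
    -- (n-1)! / ((m+1) (m+2) c! d! e! (e+k+2)!).
    𝒫-weight : ℕ → ℕ → ℕ → ℕ → ℕ → ℚ
    𝒫-weight k n c d e = fromℕ ((n ∸ 1) !) * inv-suc (c ℕ.+ e ℕ.+ k) * inv-suc (suc (c ℕ.+ e ℕ.+ k))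
                         * inv! c * inv! d * inv! e * inv! (suc (suc (e ℕ.+ k)))

    +-2+ : ∀ c e k → c ℕ.+ e ℕ.+ suc (suc k) ≡ suc (c ℕ.+ suc e ℕ.+ k)
    +-2+ = solve-∀
    +-2+ʳ : ∀ e k → e ℕ.+ suc (suc k) ≡ suc (suc (e ℕ.+ k))
    +-2+ʳ = solve-∀
    +-3+ : ∀ c e k → c ℕ.+ e ℕ.+ suc (suc (suc k)) ≡ suc (suc c ℕ.+ suc e ℕ.+ k)
    +-3+ = solve-∀
    +-3+ʳ : ∀ e k → e ℕ.+ suc (suc (suc k)) ≡ suc (suc (suc (e ℕ.+ k)))
    +-3+ʳ = solve-∀

    𝒫-term : ∀ k n c d e → n ≡ degree (suc (suc k)) c d e →
             𝒫 k n c d e ≡ 𝒫-weight k n c d e * (fromℕ (suc (suc (c ℕ.+ e ℕ.+ k))) * fromℕ (suc (e ℕ.+ k)) * fromℕ (suc (suc (e ℕ.+ k))))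
    𝒫-term k n c d e deg = ≡.trans (guard-yes (n ≟ _) deg _)
      (≡.trans (cong₂ (λ x y → fromℕ ((n ∸ 1) !) * x * inv! c * inv! d * inv! e * y) (inv-suc-split₀ m)
                (≡.trans (inv!-suc (e ℕ.+ k)) (cong (fromℕ (suc (e ℕ.+ k)) *_) (inv!-suc (suc (e ℕ.+ k))))))
        (solve 10 (λ F rm rm1 ic id ie e2 a b cc → F :* (rm :* (a :* rm1)) :* ic :* id :* ie :* (b :* (cc :* e2))
                     := (F :* rm :* rm1 :* ic :* id :* ie :* e2) :* (a :* b :* cc)) refl
           (fromℕ ((n ∸ 1) !)) (inv-suc m) (inv-suc (suc m)) (inv! c) (inv! d) (inv! e) (inv! (suc (suc (e ℕ.+ k))))
           (fromℕ (suc (suc m))) (fromℕ (suc (e ℕ.+ k))) (fromℕ (suc (suc (e ℕ.+ k))))))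
      where
      m : ℕ
      m = c ℕ.+ e ℕ.+ k

    𝒫-termᶜ : ∀ k n c d e → n ≡ degree (suc (suc k)) c d e →
             shift (λ c′ → 𝒫 (suc k) n c′ d e) c
             ≡ 𝒫-weight k n c d e * (fromℕ (suc (suc (c ℕ.+ e ℕ.+ k))) * fromℕ c * fromℕ (suc (suc (e ℕ.+ k))))
    𝒫-termᶜ k n zero d e deg = ≡.sym (zero-middle (fromℕ (suc (suc (e ℕ.+ k)))) (fromℕ (suc (suc (e ℕ.+ k)))) (𝒫-weight k n 0 d e))
    𝒫-termᶜ k n (suc c) d e deg = ≡.trans (guard-yes (n ≟ _) (≡.trans deg (≡.sym (degree-sucʲ (suc (suc k)) c d e))) _)
      (≡.trans (cong₂ (λ x y → fromℕ ((n ∸ 1) !) * x * inv! c * inv! d * inv! e * y)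
                    (≡.trans (cong inv-suc (ℕ.+-suc (c ℕ.+ e) k)) (inv-suc-split₀ m))
                    (≡.trans (cong inv! (ℕ.+-suc e k)) (inv!-suc (suc (e ℕ.+ k)))))
      (≡.trans (cong (λ x → fromℕ ((n ∸ 1) !) * (inv-suc m * (fromℕ (suc (suc m)) * inv-suc (suc m))) * x * inv! d * inv! e
                            * (fromℕ (suc (suc (e ℕ.+ k))) * inv! (suc (suc (e ℕ.+ k))))) (inv!-suc c))
        (solve 10 (λ F rm rm1 ic id ie e2 a qc cc → F :* (rm :* (a :* rm1)) :* (qc :* ic) :* id :* ie :* (cc :* e2)
                     := (F :* rm :* rm1 :* ic :* id :* ie :* e2) :* (a :* qc :* cc)) refl
           (fromℕ ((n ∸ 1) !)) (inv-suc m) (inv-suc (suc m)) (inv! (suc c)) (inv! d) (inv! e) (inv! (suc (suc (e ℕ.+ k))))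
           (fromℕ (suc (suc m))) (fromℕ (suc c)) (fromℕ (suc (suc (e ℕ.+ k)))))))
      where
      m : ℕ
      m = suc c ℕ.+ e ℕ.+ k

    𝒫-termᵉ : ∀ k n c d e → n ≡ degree (suc (suc k)) c d e →
             shift (λ e′ → 𝒫 (suc (suc k)) n c d e′) e
             ≡ 𝒫-weight k n c d e * (fromℕ (suc (c ℕ.+ e ℕ.+ k)) * fromℕ e * fromℕ (suc (suc (e ℕ.+ k))))
    𝒫-termᵉ k n c d zero deg = ≡.sym (zero-middle (fromℕ (suc (c ℕ.+ 0 ℕ.+ k))) (fromℕ (suc (suc (0 ℕ.+ k)))) (𝒫-weight k n c d 0))
    𝒫-termᵉ k n c d (suc e) deg = ≡.trans (guard-yes (n ≟ _)
        (≡.trans deg (≡.trans (degree-sucᵉ (suc (suc k)) c d e) (≡.sym (degree-sucʲ (suc (suc (suc k))) c d e)))) _)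
      (≡.trans (cong₂ (λ x y → fromℕ ((n ∸ 1) !) * x * inv! c * inv! d * inv! e * y)
                    (≡.trans (cong inv-suc (+-2+ c e k)) (inv-suc-split₁ m))
                    (≡.trans (cong inv! (+-2+ʳ e k)) (inv!-suc (suc (suc e ℕ.+ k)))))
      (≡.trans (cong (λ x → fromℕ ((n ∸ 1) !) * ((fromℕ (suc m) * inv-suc m) * inv-suc (suc m)) * inv! c * inv! d * x
                            * (fromℕ (suc (suc (suc e ℕ.+ k))) * inv! (suc (suc (suc e ℕ.+ k))))) (inv!-suc e))
        (solve 10 (λ F rm rm1 ic id ie e2 a qe cc → F :* ((a :* rm) :* rm1) :* ic :* id :* (qe :* ie) :* (cc :* e2)
                     := (F :* rm :* rm1 :* ic :* id :* ie :* e2) :* (a :* qe :* cc)) refl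
           (fromℕ ((n ∸ 1) !)) (inv-suc m) (inv-suc (suc m)) (inv! c) (inv! d) (inv! (suc e)) (inv! (suc (suc (suc e ℕ.+ k))))
           (fromℕ (suc m)) (fromℕ (suc e)) (fromℕ (suc (suc (suc e ℕ.+ k)))))))
      where
      m : ℕ
      m = c ℕ.+ suc e ℕ.+ k

    𝒫-termᶜᵉ : ∀ k n c d e → n ≡ degree (suc (suc k)) c d e →
             shift (λ c′ → shift (λ e′ → 𝒫 (suc (suc (suc k))) n c′ d e′) e) c
             ≡ 𝒫-weight k n c d e * (fromℕ (suc (c ℕ.+ e ℕ.+ k)) * fromℕ c * fromℕ e)
    𝒫-termᶜᵉ k n zero d e deg = ≡.sym (zero-middle (fromℕ (suc (0 ℕ.+ e ℕ.+ k))) (fromℕ e) (𝒫-weight k n 0 d e))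
    𝒫-termᶜᵉ k n (suc c) d zero deg = ≡.sym (zero-last (fromℕ (suc (suc c ℕ.+ 0 ℕ.+ k))) (fromℕ (suc c)) (𝒫-weight k n (suc c) d 0))
    𝒫-termᶜᵉ k n (suc c) d (suc e) deg = ≡.trans (guard-yes (n ≟ _) g _)
      (≡.trans (cong₂ (λ x y → fromℕ ((n ∸ 1) !) * x * inv! c * inv! d * inv! e * y)
                    (≡.trans (cong inv-suc (+-3+ c e k)) (inv-suc-split₁ m)) (cong inv! (+-3+ʳ e k)))
      (≡.trans (cong₂ (λ x y → fromℕ ((n ∸ 1) !) * ((fromℕ (suc m) * inv-suc m) * inv-suc (suc m)) * x * inv! d * y
                                * inv! (suc (suc (suc e ℕ.+ k)))) (inv!-suc c) (inv!-suc e))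
        (solve 10 (λ F rm rm1 ic id ie e2 a qc qe → F :* ((a :* rm) :* rm1) :* (qc :* ic) :* id :* (qe :* ie) :* e2
                     := (F :* rm :* rm1 :* ic :* id :* ie :* e2) :* (a :* qc :* qe)) refl
           (fromℕ ((n ∸ 1) !)) (inv-suc m) (inv-suc (suc m)) (inv! (suc c)) (inv! d) (inv! (suc e)) (inv! (suc (suc (suc e ℕ.+ k))))
           (fromℕ (suc m)) (fromℕ (suc c)) (fromℕ (suc e)))))
      where
      m : ℕ
      m = suc c ℕ.+ suc e ℕ.+ k
      g : n ≡ degree (suc (suc (suc (suc (suc k))))) c d e
      g = ≡.trans deg (≡.trans (cong suc (degree-sucᵉ (suc (suc k)) c d e))
            (≡.sym (≡.trans (degree-sucʲ (suc (suc (suc (suc k)))) c d e) (cong suc (degree-sucʲ (suc (suc (suc k))) c d e)))))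

    𝒲-term : ∀ k n c d e → n ≡ degree (suc (suc k)) c d e →
             𝒲 (suc (suc k)) n c d e
             ≡ 𝒫-weight k n c d e * (fromℕ (suc (suc k)) * fromℕ (suc (c ℕ.+ e ℕ.+ k)) * fromℕ (suc (suc (c ℕ.+ e ℕ.+ k))))
    𝒲-term k n c d e deg = ≡.trans (guard-yes (n ≟ _) (≡.trans deg (degree-sucʲ (suc k) c d e)) _)
      (≡.trans (cong (λ y → fromℕ (suc (suc k)) * fromℕ ((n ∸ 1) !) * inv! c * inv! d * inv! e * y) (cong inv! (+-2+ʳ e k)))
      (≡.sym (≡.trans (solve 10 (λ F rm rm1 ic id ie e2 a b b2 → (F :* rm :* rm1 :* ic :* id :* ie :* e2) :* (a :* b :* b2)
                     := (a :* F :* ic :* id :* ie :* e2) :* ((b :* rm) :* (b2 :* rm1))) refl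
           (fromℕ ((n ∸ 1) !)) (inv-suc m) (inv-suc (suc m)) (inv! c) (inv! d) (inv! e) (inv! (suc (suc (e ℕ.+ k))))
           (fromℕ (suc (suc k))) (fromℕ (suc m)) (fromℕ (suc (suc m))))
         (≡.trans (cong₂ (λ x y → (fromℕ (suc (suc k)) * fromℕ ((n ∸ 1) !) * inv! c * inv! d * inv! e * inv! (suc (suc (e ℕ.+ k))))
                                  * (x * y)) (fromℕ-suc*inv-suc m) (fromℕ-suc*inv-suc (suc m)))
            (ℚ.*-identityʳ _)))))
      where
      m : ℕ
      m = c ℕ.+ e ℕ.+ k

    𝒫-rec-on : ∀ k n c d e → n ≡ degree (suc (suc k)) c d e →
               𝒫 k n c d e + shift (λ c′ → 𝒫 (suc k) n c′ d e) c
                 - (shift (λ e′ → 𝒫 (suc (suc k)) n c d e′) e + shift (λ c′ → shift (λ e′ → 𝒫 (suc (suc (suc k))) n c′ d e′) e) c)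
               ≡ 𝒲 (suc (suc k)) n c d e
    𝒫-rec-on k n c d e deg =
      ≡.trans (cong₂ _-_ (cong₂ _+_ (𝒫-term k n c d e deg) (𝒫-termᶜ k n c d e deg))
                         (cong₂ _+_ (𝒫-termᵉ k n c d e deg) (𝒫-termᶜᵉ k n c d e deg)))
        (≡.trans (factor-out (𝒫-weight k n c d e) P₀ Pᶜ Pᵉ Pᶜᵉ)
          (≡.trans (cong (𝒫-weight k n c d e *_) ident) (≡.sym (𝒲-term k n c d e deg))))
      where
      m : ℕ
      m = c ℕ.+ e ℕ.+ k
      P₀ Pᶜ Pᵉ Pᶜᵉ : ℚ
      P₀ = fromℕ (suc (suc m)) * fromℕ (suc (e ℕ.+ k)) * fromℕ (suc (suc (e ℕ.+ k)))
      Pᶜ = fromℕ (suc (suc m)) * fromℕ c * fromℕ (suc (suc (e ℕ.+ k)))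
      Pᵉ = fromℕ (suc m) * fromℕ e * fromℕ (suc (suc (e ℕ.+ k)))
      Pᶜᵉ = fromℕ (suc m) * fromℕ c * fromℕ e
      factor-out : ∀ g a b c d → g * a + g * b - (g * c + g * d) ≡ g * (a + b - (c + d))
      factor-out = solve 5 (λ g a b c d → g :* a :+ g :* b :- (g :* c :+ g :* d) := g :* (a :+ b :- (c :+ d))) refl
      ident : P₀ + Pᶜ - (Pᵉ + Pᶜᵉ) ≡ fromℕ (suc (suc k)) * fromℕ (suc m) * fromℕ (suc (suc m))
      ident rewrite fromℕ-suc (suc m) | fromℕ-suc m | fromℕ-suc (suc (e ℕ.+ k)) | fromℕ-suc (e ℕ.+ k) | fromℕ-suc (suc k) | fromℕ-suc k
                  | fromℕ-+ (c ℕ.+ e) k | fromℕ-+ c e | fromℕ-+ e k =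
        solve 3 (λ c e k →
            (con 1ℚ :+ (con 1ℚ :+ (c :+ e :+ k))) :* (con 1ℚ :+ (e :+ k)) :* (con 1ℚ :+ (con 1ℚ :+ (e :+ k)))
            :+ (con 1ℚ :+ (con 1ℚ :+ (c :+ e :+ k))) :* c :* (con 1ℚ :+ (con 1ℚ :+ (e :+ k)))
            :- ((con 1ℚ :+ (c :+ e :+ k)) :* e :* (con 1ℚ :+ (con 1ℚ :+ (e :+ k)))
            :+ (con 1ℚ :+ (c :+ e :+ k)) :* c :* e)
          := (con 1ℚ :+ (con 1ℚ :+ k)) :* (con 1ℚ :+ (c :+ e :+ k)) :* (con 1ℚ :+ (con 1ℚ :+ (c :+ e :+ k)))) refl (fromℕ c) (fromℕ e) (fromℕ k)

    𝒫-rec-off : ∀ k n c d e → n ≢ degree (suc (suc k)) c d e →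
                𝒫 k n c d e + shift (λ c′ → 𝒫 (suc k) n c′ d e) c
                  - (shift (λ e′ → 𝒫 (suc (suc k)) n c d e′) e + shift (λ c′ → shift (λ e′ → 𝒫 (suc (suc (suc k))) n c′ d e′) e) c)
                ≡ 𝒲 (suc (suc k)) n c d e
    𝒫-rec-off k n c d e n≢ =
      ≡.trans (cong₂ _-_ (cong₂ _+_ (guard-no (n ≟ _) n≢ _) (c-off c n≢)) (cong₂ _+_ (e-off e n≢) (ce-off c e n≢)))
        (≡.sym (𝒲-off (suc (suc k)) n c d e n≢))
      where
      c-off : ∀ c → n ≢ degree (suc (suc k)) c d e → shift (λ c′ → 𝒫 (suc k) n c′ d e) c ≡ 0ℚ
      c-off zero    _  = refl
      c-off (suc c) n≢ = guard-no (n ≟ _) (λ deg → n≢ (≡.trans deg (degree-sucʲ (suc (suc k)) c d e))) _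
      e-off : ∀ e → n ≢ degree (suc (suc k)) c d e → shift (λ e′ → 𝒫 (suc (suc k)) n c d e′) e ≡ 0ℚ
      e-off zero    _  = refl
      e-off (suc e) n≢ = guard-no (n ≟ _)
        (λ deg → n≢ (≡.trans deg (≡.trans (degree-sucʲ (suc (suc (suc k))) c d e) (≡.sym (degree-sucᵉ (suc (suc k)) c d e))))) _
      ce-off : ∀ c e → n ≢ degree (suc (suc k)) c d e → shift (λ c′ → shift (λ e′ → 𝒫 (suc (suc (suc k))) n c′ d e′) e) c ≡ 0ℚ
      ce-off zero    e       _  = refl
      ce-off (suc c) zero    _  = refl
      ce-off (suc c) (suc e) n≢ = guard-no (n ≟ _) (λ deg → n≢ (≡.trans deg (≡.trans (degree-sucʲ (suc (suc (suc (suc k)))) c d e)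
        (cong suc (≡.trans (degree-sucʲ (suc (suc (suc k))) c d e) (≡.sym (degree-sucᵉ (suc (suc k)) c d e))))))) _


  𝒫-rec : ∀ k n c d e →
          𝒫 k n c d e + shift (λ c′ → 𝒫 (suc k) n c′ d e) c
            - shift (λ e′ → 𝒫 (suc (suc k)) n c d e′ + shift (λ c′ → 𝒫 (suc (suc (suc k))) n c′ d e′) c) e
          ≡ 𝒲 (suc (suc k)) n c d e
  𝒫-rec k n c d e = ≡.trans (cong (𝒫 k n c d e + shift (λ c′ → 𝒫 (suc k) n c′ d e) c -_)
                      (shift-+-shift (λ e′ → 𝒫 (suc (suc k)) n c d e′) (λ c′ e′ → 𝒫 (suc (suc (suc k))) n c′ d e′) c e))
                    ([ 𝒫-rec-on k n c d e , 𝒫-rec-off k n c d e ]′ (toSum (n ≟ degree (suc (suc k)) c d e)))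

module Solution where

  open FourVariableSeries
  open Recurrences
  open PowerCoefficients
  open QuotientCoefficients
  open import Defs using (Series; _≋_; 𝟙; x; y; z; α; _⊕_; _⊛_; _⊖_; _^_)
  open import Data.Nat as ℕ using (ℕ; zero; suc)
  import Data.Nat.Properties as ℕ
  open import Data.Rational as ℚ using (ℚ)
  open import Algebra.Bundles using (CommutativeRing)
  open CommutativeRing 𝕊 using (setoid; refl; sym; trans; +-cong; *-congˡ; *-congʳ; *-identityʳ; distribʳ; *-assoc; reflexive; ring)
  open import Algebra.Properties.Ring ring using (-‿distribˡ-*)
  open import Relation.Binary.PropositionalEquality as ≡ using (_≡_; cong; cong₂)

  module _ (M : Series) (M-eq : M ≋ 1# + (x + y) * z * M + α * z ^ˢ 2 * M ^ˢ 2) where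

    powers-coeff : ∀ j → (z * M) ^ˢ j ≋ 𝒲 j
    powers-coeff zero    n       c d e = sym 𝟙-as-1# n c d e
    powers-coeff (suc j) zero    c d e = ≡.trans (powers-rec M M-eq j zero c d e) (z*-coeff _ zero c d e)
    powers-coeff (suc j) (suc n) c d e =
      ≡.trans (powers-rec M M-eq j (suc n) c d e) (≡.trans (z*-coeff _ (suc n) c d e) (≡.trans (step-coeff _ _ _ n c d e)
        (≡.trans (cong₂ ℚ._+_ (cong₂ ℚ._+_ (cong₂ ℚ._+_ (powers-coeff j n c d e)
                                                        (shift-cong (λ c′ → powers-coeff (suc j) n c′ d e) c))
                                           (shift-cong (λ d′ → powers-coeff (suc j) n c d′ e) d))
                             (shift-cong (λ e′ → powers-coeff (suc (suc j)) n c d e′) e))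
          (≡.sym (𝒲-rec j n c d e)))))
      where
      step-coeff : ∀ A B C n c d e → (A + x * B + y * B + α * C) n c d e ≡
                   A n c d e ℚ.+ shift (λ c′ → B n c′ d e) c ℚ.+ shift (λ d′ → B n c d′ e) d ℚ.+ shift (λ e′ → C n c d e′) e
      step-coeff A B C n c d e = ≡.trans (+-coeff _ _ n c d e) (cong₂ ℚ._+_ (≡.trans (+-coeff _ _ n c d e)
        (cong₂ ℚ._+_ (≡.trans (+-coeff _ _ n c d e) (cong (A n c d e ℚ.+_) (x*-coeff B n c d e))) (y*-coeff B n c d e)))
        (α*-coeff C n c d e))

    Φ-𝒫 : ∀ k → Φ 𝒫 k ≋ (z * M) ^ˢ suc (suc k)
    Φ-𝒫 k n c d e = ≡.trans (Φ-coeff 𝒫 k n c d e) (≡.trans (𝒫-rec k n c d e) (≡.sym (powers-coeff (suc (suc k)) n c d e)))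

    solution : ∀ L a b s →
               L * ((1# + x * z * M) * (1# - α * z ^ˢ 2 * M ^ˢ 2)) ≋ α * (z * M) ^ˢ suc (suc a) - α ^ˢ s * (z * M) ^ˢ suc (suc b) →
               L ≋ α * 𝒫 a + (- α ^ˢ s) * 𝒫 b
    solution L a b s L-eq = trans (sym (*-identityʳ L)) (Φ-injective U V ΦU≋ΦV 0)
      where
      w : Series
      w = z * M
      U V : ℕ → Series
      U j = L * w ^ˢ j
      V j = α * 𝒫 (j ℕ.+ a) + (- α ^ˢ s) * 𝒫 (j ℕ.+ b)
      power-shift : ∀ j m → w ^ˢ suc (suc m) * w ^ˢ j ≋ w ^ˢ suc (suc (j ℕ.+ m))
      power-shift j m = trans (sym (^-homo-* w (suc (suc m)) j)) (reflexive (cong (λ i → w ^ˢ suc (suc i)) (ℕ.+-comm m j)))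
      ΦU≋ΦV : ∀ j → Φ U j ≋ Φ V j
      ΦU≋ΦV j = begin
        Φ U j                                                        ≈⟨ Φ-powers M L _ L-eq j ⟩
        (α * w ^ˢ suc (suc a) - α ^ˢ s * w ^ˢ suc (suc b)) * w ^ˢ j  ≈⟨ distribʳ _ _ _ ⟩
        α * w ^ˢ suc (suc a) * w ^ˢ j + - (α ^ˢ s * w ^ˢ suc (suc b)) * w ^ˢ j
          ≈⟨ +-cong (trans (*-assoc _ _ _) (*-congˡ (power-shift j a)))
                    (trans (*-congʳ (-‿distribˡ-* _ _)) (trans (*-assoc _ _ _) (*-congˡ (power-shift j b)))) ⟩
        α * w ^ˢ suc (suc (j ℕ.+ a)) + (- α ^ˢ s) * w ^ˢ suc (suc (j ℕ.+ b))
          ≈⟨ +-cong (*-congˡ (sym (Φ-𝒫 (j ℕ.+ a)))) (*-congˡ (sym (Φ-𝒫 (j ℕ.+ b)))) ⟩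
        α * Φ 𝒫 (j ℕ.+ a) + (- α ^ˢ s) * Φ 𝒫 (j ℕ.+ b)
          ≈⟨ sym (Φ-linear α (- α ^ˢ s) (λ i → 𝒫 (i ℕ.+ a)) (λ i → 𝒫 (i ℕ.+ b)) j) ⟩
        Φ V j ∎
        where open import Relation.Binary.Reasoning.Setoid setoid

    solution-coeff : ∀ L a b s →
                     L * ((1# + x * z * M) * (1# - α * z ^ˢ 2 * M ^ˢ 2)) ≋ α * (z * M) ^ˢ suc (suc a) - α ^ˢ s * (z * M) ^ˢ suc (suc b) →
                     ∀ n c d e → L n c d e ≡ shift (λ e′ → 𝒫 a n c d e′) e ℚ.- shiftBy s (λ e′ → 𝒫 b n c d e′) e
    solution-coeff L a b s L-eq n c d e = ≡.trans (solution L a b s L-eq n c d e) (≡.trans (+-coeff _ _ n c d e)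
      (cong₂ ℚ._+_ (α*-coeff _ n c d e) (≡.trans (neg*-coeff _ _ n c d e) (cong ℚ.-_ (α^*-coeff s _ n c d e)))))

  module _ (M : Series) where
    open import Relation.Binary.Reasoning.Setoid setoid

    M-equation : M ≋ 𝟙 ⊕ (x ⊕ y) ⊛ z ⊛ M ⊕ α ⊛ z ^ 2 ⊛ M ^ 2 → M ≋ 1# + (x + y) * z * M + α * z ^ˢ 2 * M ^ˢ 2
    M-equation M-eq =
      trans M-eq (⊕⇒+ (⊕⇒+ 𝟙-as-1# (⊛⇒* (⊛⇒* (⊕⇒+ refl refl) refl) refl)) (⊛⇒* (⊛⇒* refl (^⇒^ 2 refl)) (^⇒^ 2 refl)))

    L-equation : ∀ L f k →
                 L ⊛ ((𝟙 ⊕ x ⊛ z ⊛ M) ⊛ (𝟙 ⊖ α ⊛ z ^ 2 ⊛ M ^ 2))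
                   ≋ α ⊛ (z ⊛ M) ^ ((f ℕ.+ k) ℕ.∸ f ℕ.+ 2) ⊖ α ^ (f ℕ.+ 1) ⊛ (z ⊛ M) ^ (f ℕ.+ (f ℕ.+ k) ℕ.+ 2) →
                 L * ((1# + x * z * M) * (1# - α * z ^ˢ 2 * M ^ˢ 2))
                   ≋ α * (z * M) ^ˢ suc (suc k) - α ^ˢ suc f * (z * M) ^ˢ suc (suc (f ℕ.+ (f ℕ.+ k)))
    L-equation L f k L-eq = begin
      L * ((1# + x * z * M) * (1# - α * z ^ˢ 2 * M ^ˢ 2))
        ≈⟨ ⊛⇒* refl (⊛⇒* (⊕⇒+ 𝟙-as-1# (⊛⇒* (⊛⇒* refl refl) refl))
                         (⊖⇒- 𝟙-as-1# (⊛⇒* (⊛⇒* refl (^⇒^ 2 refl)) (^⇒^ 2 refl)))) ⟨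
      L ⊛ ((𝟙 ⊕ x ⊛ z ⊛ M) ⊛ (𝟙 ⊖ α ⊛ z ^ 2 ⊛ M ^ 2))
        ≈⟨ L-eq ⟩
      α ⊛ (z ⊛ M) ^ ((f ℕ.+ k) ℕ.∸ f ℕ.+ 2) ⊖ α ^ (f ℕ.+ 1) ⊛ (z ⊛ M) ^ (f ℕ.+ (f ℕ.+ k) ℕ.+ 2)
        ≈⟨ ⊖⇒- (⊛⇒* refl (^⇒^ ((f ℕ.+ k) ℕ.∸ f ℕ.+ 2) (⊛⇒* refl refl)))
                (⊛⇒* (^⇒^ (f ℕ.+ 1) refl) (^⇒^ (f ℕ.+ (f ℕ.+ k) ℕ.+ 2) (⊛⇒* refl refl))) ⟩
      α * (z * M) ^ˢ ((f ℕ.+ k) ℕ.∸ f ℕ.+ 2) - α ^ˢ (f ℕ.+ 1) * (z * M) ^ˢ (f ℕ.+ (f ℕ.+ k) ℕ.+ 2)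
        ≡⟨ ≡.cong₂ (λ i j → α * (z * M) ^ˢ i - α ^ˢ j * (z * M) ^ˢ (f ℕ.+ (f ℕ.+ k) ℕ.+ 2))
                   (≡.trans (cong (ℕ._+ 2) (ℕ.m+n∸m≡n f k)) (ℕ.+-comm k 2)) (ℕ.+-comm f 1) ⟩
      α * (z * M) ^ˢ suc (suc k) - α ^ˢ suc f * (z * M) ^ˢ (f ℕ.+ (f ℕ.+ k) ℕ.+ 2)
        ≡⟨ cong (λ i → α * (z * M) ^ˢ suc (suc k) - α ^ˢ suc f * (z * M) ^ˢ i) (ℕ.+-comm (f ℕ.+ (f ℕ.+ k)) 2) ⟩
      α * (z * M) ^ˢ suc (suc k) - α ^ˢ suc f * (z * M) ^ˢ suc (suc (f ℕ.+ (f ℕ.+ k))) ∎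

  L-coeff : ∀ n f k M L →
            M ≋ 𝟙 ⊕ (x ⊕ y) ⊛ z ⊛ M ⊕ α ⊛ z ^ 2 ⊛ M ^ 2 →
            L ⊛ ((𝟙 ⊕ x ⊛ z ⊛ M) ⊛ (𝟙 ⊖ α ⊛ z ^ 2 ⊛ M ^ 2))
              ≋ α ⊛ (z ⊛ M) ^ ((f ℕ.+ k) ℕ.∸ f ℕ.+ 2) ⊖ α ^ (f ℕ.+ 1) ⊛ (z ⊛ M) ^ (f ℕ.+ (f ℕ.+ k) ℕ.+ 2) →
            ∀ c d e → L n c d e ≡ shift (λ e′ → 𝒫 k n c d e′) e ℚ.- shiftBy (suc f) (λ e′ → 𝒫 (f ℕ.+ (f ℕ.+ k)) n c d e′) e
  L-coeff n f k M L M-eq L-eq c d e =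
    solution-coeff M (M-equation M M-eq) L k (f ℕ.+ (f ℕ.+ k)) (suc f) (L-equation M L f k L-eq) n c d e

module RightHandSide where

  open FourVariableSeries using (shift; shiftBy; shiftBy-<; shiftBy-+)
  open FactorialArithmetic
  open PowerCoefficients
  open QuotientCoefficients
  open import Defs using (invFact; recip; rhsCoeff)
  open import Data.Nat as ℕ using (ℕ; zero; suc; _∸_; _≟_; _!; _<_; s≤s)
  import Data.Nat.Properties as ℕ
  import Data.Nat.Tactic.RingSolver as ℕ-Solver
  open import Data.Integer as ℤ using (ℤ; +_; -[1+_])
  import Data.Integer.Properties as ℤ
  import Data.Integer.Tactic.RingSolver as ℤ-Solver
  open import Data.Rational using (ℚ; 0ℚ; _/_; _+_; _-_; _*_)
  import Data.Rational.Properties as ℚ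
  open import Data.Rational.Solver using (module +-*-Solver)
  open import Data.List using ([]; _∷_)
  open import Data.Product using (∃; _,_; proj₁; proj₂)
  open import Data.Sum using (_⊎_; inj₁; inj₂)
  open import Relation.Nullary using (¬_; yes; no)
  open import Relation.Binary.PropositionalEquality as ≡ using (_≡_; refl; cong; cong₂)

  +-minus : ∀ {a} b m → a ≡ m ℕ.+ b → + a ℤ.- + b ≡ + m
  +-minus b m refl = ≡.trans (ℤ.[+m]-[+n]≡m⊖n (m ℕ.+ b) b)
    (≡.trans (ℤ.⊖-≥ (ℕ.m≤n+m b m)) (cong +_ (ℕ.m+n∸n≡m m b)))

  private
    cancel-middle : ∀ x y z → x ℤ.- y ℤ.+ (y ℤ.+ z) ℤ.- ℤ.1ℤ ≡ x ℤ.+ z ℤ.- ℤ.1ℤ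
    cancel-middle = ℤ-Solver.solve-∀

    +-minus-larger : ∀ e j → + e ℤ.- + (e ℕ.+ j) ℤ.- + 1 ≡ -[1+ j ]
    +-minus-larger e j = ≡.trans (cong (ℤ._- + 1) (≡.trans (ℤ.[+m]-[+n]≡m⊖n e (e ℕ.+ j))
      (≡.trans (ℤ.⊖-≤ (ℕ.m≤m+n e j)) (cong (λ i → ℤ.- (+ i)) (ℕ.m+n∸m≡n e j))))) (neg-minus-one j)
      where
      neg-minus-one : ∀ j → ℤ.- (+ j) ℤ.- + 1 ≡ -[1+ j ]
      neg-minus-one zero    = refl
      neg-minus-one (suc j) = cong (λ i → -[1+ suc i ]) (ℕ.+-identityʳ j)

  below-or-above : ∀ m e → e < m ⊎ ∃ λ e″ → m ℕ.+ e″ ≡ e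
  below-or-above m e with e ℕ.<? m
  ... | yes e<m = inj₁ e<m
  ... | no  e≮m = inj₂ (ℕ.m≤n⇒∃[o]m+o≡n (ℕ.≮⇒≥ e≮m))

  -- The parameter t of the theorem is f + k here.
  module _ (n f k c d : ℕ) where

    N! : ℚ
    N! = + ((n ∸ 1) !) / 1

    -- rhsCoeff f t n c d e is N! * (term A B C - term A′ B′ C′) for the integer arguments written there.
    term : ℤ → ℤ → ℤ → ℚ
    term A B C = recip A * invFact (+ c) * invFact (+ d) * invFact B * invFact C

    term-cong : ∀ {A A′ B B′ C C′} → A ≡ A′ → B ≡ B′ → C ≡ C′ → term A B C ≡ term A′ B′ C′
    term-cong refl refl refl = refl

    term-zero : ∀ A j C → term A -[1+ j ] C ≡ 0ℚ
    term-zero A j C = ≡.trans (cong (_* invFact C) (ℚ.*-zeroʳ (recip A * invFact (+ c) * invFact (+ d)))) (ℚ.*-zeroˡ (invFact C))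

    N!*term-zero : ∀ A j C → N! * term A -[1+ j ] C ≡ 0ℚ
    N!*term-zero A j C = ≡.trans (cong (N! *_) (term-zero A j C)) (ℚ.*-zeroʳ N!)

    𝒫-value : ∀ j e → n ≡ degree (suc (suc j)) c d e → 𝒫 j n c d e ≡ N! * term (+ suc (c ℕ.+ e ℕ.+ j)) (+ e) (+ (e ℕ.+ j))
    𝒫-value j e deg = ≡.trans (guard-yes (n ≟ _) deg _) unfold
      where
      open +-*-Solver using (solve; _:*_; _:=_)
      unfold : fromℕ ((n ∸ 1) !) * inv-suc (c ℕ.+ e ℕ.+ j) * inv! c * inv! d * inv! e * inv! (e ℕ.+ j)
               ≡ N! * term (+ suc (c ℕ.+ e ℕ.+ j)) (+ e) (+ (e ℕ.+ j))
      unfold = ≡.trans (solve 6 (λ F r a b x y → F :* r :* a :* b :* x :* y := F :* (r :* a :* b :* x :* y)) refl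
          (fromℕ ((n ∸ 1) !)) (inv-suc (c ℕ.+ e ℕ.+ j)) (inv! c) (inv! d) (inv! e) (inv! (e ℕ.+ j)))
        (cong₂ _*_ (fromℕ-def _) (cong₂ _*_ (cong₂ _*_ (cong₂ _*_ (cong₂ _*_ (inv-suc-def _) (inv!-def c)) (inv!-def d)) (inv!-def e)) (inv!-def _)))

    Homogeneous : ℕ → Set
    Homogeneous e = c ℕ.+ d ℕ.+ 2 ℕ.* e ℕ.+ (f ℕ.+ k) ≡ n ℕ.+ f

    private
      homogeneous₁ : ∀ e → c ℕ.+ d ℕ.+ 2 ℕ.* suc e ℕ.+ (f ℕ.+ k) ≡ c ℕ.+ d ℕ.+ (e ℕ.+ e) ℕ.+ suc (suc k) ℕ.+ f
      homogeneous₁ e = ℕ-Solver.solve (c ∷ d ∷ e ∷ f ∷ k ∷ [])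

      homogeneous₂ : ∀ e → c ℕ.+ d ℕ.+ 2 ℕ.* (suc f ℕ.+ e) ℕ.+ (f ℕ.+ k)
                           ≡ c ℕ.+ d ℕ.+ (e ℕ.+ e) ℕ.+ suc (suc (f ℕ.+ (f ℕ.+ k))) ℕ.+ f
      homogeneous₂ e = ℕ-Solver.solve (c ∷ d ∷ e ∷ f ∷ k ∷ [])

      split₁ : ∀ e → c ℕ.+ d ℕ.+ (e ℕ.+ e) ℕ.+ suc (suc k) ≡ suc (c ℕ.+ e ℕ.+ k) ℕ.+ suc e ℕ.+ d
      split₁ e = ℕ-Solver.solve (c ∷ d ∷ e ∷ k ∷ [])

      split₂ : ∀ e → c ℕ.+ d ℕ.+ (e ℕ.+ e) ℕ.+ suc (suc (f ℕ.+ (f ℕ.+ k))) ≡ c ℕ.+ e ℕ.+ (f ℕ.+ k) ℕ.+ 1 ℕ.+ suc (f ℕ.+ e) ℕ.+ d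
      split₂ e = ℕ-Solver.solve (c ∷ d ∷ e ∷ f ∷ k ∷ [])

      regroup₂ : ∀ e → c ℕ.+ e ℕ.+ (f ℕ.+ k) ℕ.+ 1 ℕ.+ f ≡ suc (c ℕ.+ e ℕ.+ (f ℕ.+ (f ℕ.+ k)))
      regroup₂ e = ℕ-Solver.solve (c ∷ e ∷ f ∷ k ∷ [])

      regroup₃ : ∀ e → suc (f ℕ.+ e) ℕ.+ (f ℕ.+ k) ≡ e ℕ.+ (f ℕ.+ (f ℕ.+ k)) ℕ.+ 1
      regroup₃ e = ℕ-Solver.solve (e ∷ f ∷ k ∷ [])

    first-on : ∀ e → Homogeneous e → shift (λ e′ → 𝒫 k n c d e′) e
               ≡ N! * term (+ n ℤ.- + d ℤ.- + e) (+ e ℤ.- + 1) (+ e ℤ.- + f ℤ.+ + (f ℕ.+ k) ℤ.- + 1)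
    first-on zero    _   = ≡.sym (N!*term-zero (+ n ℤ.- + d ℤ.- + 0) 0 (+ 0 ℤ.- + f ℤ.+ + (f ℕ.+ k) ℤ.- + 1))
    first-on (suc e) hom = ≡.trans (𝒫-value k e deg) (cong (N! *_) (≡.sym (term-cong A≡ B≡ C≡)))
      where
      deg : n ≡ degree (suc (suc k)) c d e
      deg = ≡.sym (ℕ.+-cancelʳ-≡ f _ _ (≡.trans (≡.sym (homogeneous₁ e)) hom))
      A≡ : + n ℤ.- + d ℤ.- + suc e ≡ + suc (c ℕ.+ e ℕ.+ k)
      A≡ = ≡.trans (cong (ℤ._- + suc e) (+-minus d (suc (c ℕ.+ e ℕ.+ k) ℕ.+ suc e) (≡.trans deg (split₁ e))))
                   (+-minus (suc e) _ refl)
      B≡ : + suc e ℤ.- + 1 ≡ + e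
      B≡ = +-minus 1 e (ℕ.+-comm 1 e)
      C≡ : + suc e ℤ.- + f ℤ.+ + (f ℕ.+ k) ℤ.- + 1 ≡ + (e ℕ.+ k)
      C≡ = ≡.trans (cong (λ i → + suc e ℤ.- + f ℤ.+ i ℤ.- + 1) (ℤ.pos-+ f k))
             (≡.trans (cancel-middle (+ suc e) (+ f) (+ k)) (≡.trans (cong (ℤ._- + 1) (≡.sym (ℤ.pos-+ (suc e) k)))
               (+-minus 1 (e ℕ.+ k) (ℕ.+-comm 1 (e ℕ.+ k)))))

    first-off : ∀ e → ¬ Homogeneous e → shift (λ e′ → 𝒫 k n c d e′) e ≡ 0ℚ
    first-off zero    _    = refl
    first-off (suc e) ¬hom = guard-no (n ≟ _) (λ deg → ¬hom (≡.trans (homogeneous₁ e) (cong (ℕ._+ f) (≡.sym deg)))) _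

    second-on : ∀ e → Homogeneous e → shiftBy (suc f) (λ e′ → 𝒫 (f ℕ.+ (f ℕ.+ k)) n c d e′) e
                ≡ N! * term (+ n ℤ.- + d ℤ.- + e ℤ.+ + f) (+ e ℤ.- + f ℤ.- + 1) (+ e ℤ.+ + (f ℕ.+ k) ℤ.- + 1)
    second-on e hom with below-or-above (suc f) e
    ... | inj₁ (s≤s e≤f) = ≡.trans (shiftBy-< (suc f) _ e (s≤s e≤f))
        (≡.sym (≡.trans (cong (λ B → N! * term A B C) B≡) (N!*term-zero A j C)))
      where
      A C : ℤ
      A = + n ℤ.- + d ℤ.- + e ℤ.+ + f
      C = + e ℤ.+ + (f ℕ.+ k) ℤ.- + 1
      j : ℕ
      j = proj₁ (ℕ.m≤n⇒∃[o]m+o≡n e≤f)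
      B≡ : + e ℤ.- + f ℤ.- + 1 ≡ -[1+ j ]
      B≡ = ≡.trans (cong (λ i → + e ℤ.- + i ℤ.- + 1) (≡.sym (proj₂ (ℕ.m≤n⇒∃[o]m+o≡n e≤f)))) (+-minus-larger e j)
    ... | inj₂ (e″ , refl) = ≡.trans (shiftBy-+ (suc f) _ e″) (≡.trans (𝒫-value (f ℕ.+ (f ℕ.+ k)) e″ deg)
        (cong (N! *_) (≡.sym (term-cong A≡ B≡ C≡))))
      where
      deg : n ≡ degree (suc (suc (f ℕ.+ (f ℕ.+ k)))) c d e″
      deg = ≡.sym (ℕ.+-cancelʳ-≡ f _ _ (≡.trans (≡.sym (homogeneous₂ e″)) hom))
      X : ℕ
      X = c ℕ.+ e″ ℕ.+ (f ℕ.+ k) ℕ.+ 1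
      A≡ : + n ℤ.- + d ℤ.- + suc (f ℕ.+ e″) ℤ.+ + f ≡ + suc (c ℕ.+ e″ ℕ.+ (f ℕ.+ (f ℕ.+ k)))
      A≡ = ≡.trans (cong (ℤ._+ + f) (≡.trans (cong (ℤ._- + suc (f ℕ.+ e″)) (+-minus d (X ℕ.+ suc (f ℕ.+ e″)) (≡.trans deg (split₂ e″))))
                                             (+-minus (suc (f ℕ.+ e″)) X refl)))
             (≡.trans (≡.sym (ℤ.pos-+ X f)) (cong +_ (regroup₂ e″)))
      B≡ : + suc (f ℕ.+ e″) ℤ.- + f ℤ.- + 1 ≡ + e″
      B≡ = ≡.trans (cong (ℤ._- + 1) (+-minus f (suc e″) (ℕ-Solver.solve (e″ ∷ f ∷ []))))
                   (+-minus 1 e″ (ℕ.+-comm 1 e″))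
      C≡ : + suc (f ℕ.+ e″) ℤ.+ + (f ℕ.+ k) ℤ.- + 1 ≡ + (e″ ℕ.+ (f ℕ.+ (f ℕ.+ k)))
      C≡ = ≡.trans (cong (ℤ._- + 1) (≡.sym (ℤ.pos-+ (suc (f ℕ.+ e″)) (f ℕ.+ k))))
                   (+-minus 1 (e″ ℕ.+ (f ℕ.+ (f ℕ.+ k))) (regroup₃ e″))

    second-off : ∀ e → ¬ Homogeneous e → shiftBy (suc f) (λ e′ → 𝒫 (f ℕ.+ (f ℕ.+ k)) n c d e′) e ≡ 0ℚ
    second-off e ¬hom with below-or-above (suc f) e
    ... | inj₁ e<sf        = shiftBy-< (suc f) _ e e<sf
    ... | inj₂ (e″ , refl) = ≡.trans (shiftBy-+ (suc f) _ e″)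
        (guard-no (n ≟ _) (λ deg → ¬hom (≡.trans (homogeneous₂ e″) (cong (ℕ._+ f) (≡.sym deg)))) _)

    coefficient-on : ∀ e → Homogeneous e →
                     shift (λ e′ → 𝒫 k n c d e′) e - shiftBy (suc f) (λ e′ → 𝒫 (f ℕ.+ (f ℕ.+ k)) n c d e′) e
                     ≡ rhsCoeff f (f ℕ.+ k) n c d e
    coefficient-on e hom = ≡.trans (cong₂ _-_ (first-on e hom) (second-on e hom)) (*-distribˡ-- N! _ _)
      where
      open +-*-Solver using (solve; _:*_; _:-_; _:=_)
      *-distribˡ-- : ∀ a p q → a * p - a * q ≡ a * (p - q)
      *-distribˡ-- = solve 3 (λ a p q → a :* p :- a :* q := a :* (p :- q)) refl

    coefficient-off : ∀ e → ¬ Homogeneous e →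
                      shift (λ e′ → 𝒫 k n c d e′) e - shiftBy (suc f) (λ e′ → 𝒫 (f ℕ.+ (f ℕ.+ k)) n c d e′) e ≡ 0ℚ
    coefficient-off e ¬hom = cong₂ _-_ (first-off e ¬hom) (second-off e ¬hom)

open import Defs
open import Data.Nat using (ℕ; _+_; _*_; _∸_; _≤_)
open import Data.Rational using (0ℚ)
open import Data.Product using (_×_)
open import Relation.Binary.PropositionalEquality using (_≡_; _≢_)

import Data.Nat.Properties as ℕ
open import Data.Product using (_,_)
open import Relation.Binary.PropositionalEquality using (refl; trans)
open Solution using (L-coeff)
open RightHandSide using (coefficient-on; coefficient-off)

lemma26 : (n f t : ℕ) → 1 ≤ n → 1 ≤ f → f ≤ t →
          (M L : Series) →
          M ≋ 𝟙 ⊕ (x ⊕ y) ⊛ z ⊛ M ⊕ α ⊛ z ^ 2 ⊛ M ^ 2 →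
          L ⊛ ((𝟙 ⊕ x ⊛ z ⊛ M) ⊛ (𝟙 ⊖ α ⊛ z ^ 2 ⊛ M ^ 2))
            ≋ α ⊛ (z ⊛ M) ^ (t ∸ f + 2) ⊖ α ^ (f + 1) ⊛ (z ⊛ M) ^ (f + t + 2) →
          (c d e : ℕ) →
            (c + d + 2 * e + t ≡ n + f → L n c d e ≡ rhsCoeff f t n c d e)
            × (c + d + 2 * e + t ≢ n + f → L n c d e ≡ 0ℚ)
lemma26 n f t _ _ f≤t M L M-eq L-eq c d e with ℕ.m≤n⇒∃[o]m+o≡n f≤t
... | k , refl = (λ hom → trans (L-coeff n f k M L M-eq L-eq c d e) (coefficient-on n f k c d e hom))
               , (λ ¬hom → trans (L-coeff n f k M L M-eq L-eq c d e) (coefficient-off n f k c d e ¬hom))
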